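{- Let $T$ be a strong semicomplete digraph on $t\ge 2$ vertices and let $H_1,\dots,H_t$ be arbitrary digraphs, each with at least two vertices. Then $Q=T[H_1,\dots,H_t]$ has a good decomposition if and only if $Q$ is not isomorphic to any of the three digraphs $\overrightarrow{C}_3[\overline{K_2},\overline{K_2},\overline{K_2}]$, $\overrightarrow{C}_3[\overrightarrow{P}_2,\overline{K_2},\overline{K_2}]$, $\overrightarrow{C}_3[\overline{K_2},\overline{K_2},\overline{K_3}]$.
   Context: All digraphs are finite, without loops or parallel arcs. A digraph is strong if for every ordered pair of distinct vertices $x,y$ there is a directed path from $x$ to $y$. A digraph is semicomplete if there is at least one arc between every pair of distinct vertices. A digraph $D=(V,A)$ has a good decomposition if $A$ contains two disjoint sets $A_1,A_2$ with both $(V,A_1)$ and $(V,A_2)$ strong. $\overline{K_p}$ is the digraph on $p$ vertices with no arcs; $\overrightarrow{C}_k$ is the directed cycle on $k$ vertices; $\overrightarrow{P}_k$ is the directed path on $k$ vertices (so $\overrightarrow{P}_2$ is two vertices with one arc). Composition: if $T$ has vertices $u_1,\dots,u_t$ and $H_i$ has vertices $u_{i,1},\dots,u_{i,n_i}$, then $T[H_1,\dots,H_t]$ has vertex set $\{u_{i,j}\}$ and arc set $\bigcup_{i} A(H_i)\cup\{u_{i,j}u_{p,q}: u_iu_p\in A(T)\}$ (all $j,q$). -}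

module Defs where

open import Data.Nat using (ℕ; zero; suc; _≤_)
open import Data.Fin using (Fin; zero; suc; _≟_)
open import Data.Bool using (Bool; true; false)
open import Data.Product using (Σ; _×_; _,_)
open import Data.Sum using (_⊎_)
open import Relation.Nullary using (¬_; yes; no)
open import Relation.Binary.PropositionalEquality using (_≡_; _≢_; refl)
open import Function.Bundles using (_⤖_; Bijection)

-- A relation automatically excludes
-- parallel arcs; loops are excluded by the predicate Loopless.
Digraph : Set → Set
Digraph V = V → V → Bool

Loopless : {V : Set} → Digraph V → Set
Loopless {V} D = ∀ (x : V) → D x x ≡ false

data Reach {V : Set} (D : Digraph V) : V → V → Set where
  here : ∀ {x} → Reach D x x
  step : ∀ {x y z} → D x y ≡ true → Reach D y z → Reach D x z

Strong : {V : Set} → Digraph V → Set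
Strong {V} D = ∀ (x y : V) → x ≢ y → Reach D x y

Semicomplete : {V : Set} → Digraph V → Set
Semicomplete {V} D = ∀ (x y : V) → x ≢ y → (D x y ≡ true) ⊎ (D y x ≡ true)

_⊆A_ : {V : Set} → Digraph V → Digraph V → Set
_⊆A_ {V} A₁ D = ∀ (x y : V) → A₁ x y ≡ true → D x y ≡ true

HasGoodDecomposition : {V : Set} → Digraph V → Set
HasGoodDecomposition {V} D =
  Σ (Digraph V) λ A₁ → Σ (Digraph V) λ A₂ →
    (A₁ ⊆A D) × (A₂ ⊆A D) ×
    (∀ (x y : V) → ¬ ((A₁ x y ≡ true) × (A₂ x y ≡ true))) ×
    Strong A₁ × Strong A₂

_≅_ : {V W : Set} → Digraph V → Digraph W → Set
_≅_ {V} {W} D E = Σ (V ⤖ W) λ f →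
  ∀ (x y : V) → D x y ≡ E (Bijection.to f x) (Bijection.to f y)

-- composition T[H_1,…,H_t]; vertex u_{i,j} is the pair (i , j)
compose : {t : ℕ} (T : Digraph (Fin t)) {ns : Fin t → ℕ}
  (H : (i : Fin t) → Digraph (Fin (ns i))) →
  Digraph (Σ (Fin t) (λ i → Fin (ns i)))
compose T H (i , j) (p , q) with i ≟ p
... | yes refl = H i j q
... | no _ = T i p

Kbar : (p : ℕ) → Digraph (Fin p)
Kbar p x y = false

P2 : Digraph (Fin 2)
P2 zero (suc zero) = true
P2 _ _ = false

C3 : Digraph (Fin 3)
C3 zero (suc zero) = true
C3 (suc zero) (suc (suc zero)) = true
C3 (suc (suc zero)) zero = true
C3 _ _ = false

sizes222 sizes223 : Fin 3 → ℕ
sizes222 _ = 2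
sizes223 (suc (suc zero)) = 3
sizes223 _ = 2

H-K2K2K2 : (i : Fin 3) → Digraph (Fin (sizes222 i))
H-K2K2K2 _ = Kbar 2

H-P2K2K2 : (i : Fin 3) → Digraph (Fin (sizes222 i))
H-P2K2K2 zero = P2
H-P2K2K2 _ = Kbar 2

H-K2K2K3 : (i : Fin 3) → Digraph (Fin (sizes223 i))
H-K2K2K3 zero = Kbar 2
H-K2K2K3 (suc zero) = Kbar 2
H-K2K2K3 (suc (suc zero)) = Kbar 3

Exc1 : Digraph (Σ (Fin 3) (λ i → Fin (sizes222 i)))
Exc1 = compose C3 H-K2K2K2

Exc2 : Digraph (Σ (Fin 3) (λ i → Fin (sizes222 i)))
Exc2 = compose C3 H-P2K2K2

Exc3 : Digraph (Σ (Fin 3) (λ i → Fin (sizes223 i)))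
Exc3 = compose C3 H-K2K2K3

-- If T has a 2-cycle, or a 4-cycle v₁v₂v₃v₄ with v₃ ≠ v₁, give the arc v₁v₂ voltage 1 and every other
-- arc voltage 0: in the 2-lift of T this cycle joins the two sheets, and so it does for the complementary
-- voltage. The two lifts are strong and arc-disjoint, and each pulls back to a strong spanning subdigraph
-- of Q = T[H₁,…,H_t] once every vertex of a blob imitates one of two fixed representatives.
-- Otherwise T is a strong tournament with no 4-cycle, i.e. the 3-cycle, and Q = C⃗₃[H₁,H₂,H₃]. Up to
-- rotation, Q then either contains one of seven small blow-ups of C⃗₃ (a big blob, two medium blobs, or
-- a few arcs inside the blobs) for which an explicit pair of arc-disjoint strong spanning subdigraphs
-- absorbs all remaining vertices in the same way, or Q is one of the three exceptions. For these, a
-- case analysis on how a good decomposition would split the arcs always finds a vertex cut left by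
-- no arc of one of the two halves.
module Submission where

open import Defs
open import Data.Nat using (ℕ; suc; _≤_; s≤s; z≤n)
open import Data.Nat.Properties using (≤-reflexive)
open import Data.Fin using (Fin; _≟_; inject≤)
open import Data.Fin.Patterns using (0F; 1F; 2F; 3F)
open import Data.Fin.Properties using (any?; all?; inject≤-injective)
open import Data.Bool using (Bool; true; false; _∧_; _∨_; not; _xor_)
open import Data.Bool.Properties using (∧-conicalˡ; ∧-conicalʳ; ∧-zeroʳ; ∨-zeroʳ; ¬-not)
import Data.Bool.Properties as Bool
open import Data.List as List using (List; []; _∷_)
open import Data.List.Membership.Propositional using (_∈_)
import Data.List.Membership.DecPropositional as DecMembership
open import Data.List.Relation.Unary.Any using (here; there)
open import Data.Vec as Vec using (Vec; fromList; _∷_; [])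
import Data.Vec.Properties as Vec
open import Data.Product using (Σ; ∃; ∃-syntax; _×_; _,_; proj₁; proj₂; uncurry)
import Data.Product.Properties as Product
open import Data.Sum using (_⊎_; inj₁; inj₂; [_,_]′)
import Data.Sum as Sum
open import Data.Empty using (⊥; ⊥-elim)
open import Function using (_∘_; _∘′_; id)
open import Function.Bundles using (_⇔_; mk⇔; Bijection; Inverse; mk↔ₛ′)
open import Function.Properties.Bijection using (⤖⇒↔)
open import Function.Properties.Inverse using (↔⇒⤖)
open import Relation.Nullary using (¬_; Dec; yes; no; does; ¬?)
open import Relation.Nullary.Decidable
  using (True; toWitness; map′; dec-true; dec-false; decidable-stable; _×-dec_; _⊎-dec_; _→-dec_)
open import Relation.Unary using (Decidable)
open import Relation.Binary.Definitions using (DecidableEquality)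
open import Relation.Binary.PropositionalEquality
  using (_≡_; _≢_; refl; sym; trans; cong; cong₂; subst; subst₂)

false≢true : false ≢ true
false≢true ()

arc⇒≢ : {V : Set} {D : Digraph V} → Loopless D → ∀ {x y} → D x y ≡ true → x ≢ y
arc⇒≢ loopless {x} arc refl = false≢true (trans (sym (loopless x)) arc)

_◅◅_ : {V : Set} {D : Digraph V} {x y z : V} → Reach D x y → Reach D y z → Reach D x z
here ◅◅ r = r
step e p ◅◅ r = step e (p ◅◅ r)

Reach-map : {V W : Set} {D : Digraph V} {E : Digraph W} (f : V → W) →
  (∀ {x y} → D x y ≡ true → E (f x) (f y) ≡ true) →
  ∀ {x y} → Reach D x y → Reach E (f x) (f y)
Reach-map f hom here = here
Reach-map f hom (step e r) = step (hom e) (Reach-map f hom r)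

first-arc : {V : Set} {D : Digraph V} {x y : V} → Reach D x y → x ≢ y → ∃[ z ] D x z ≡ true
first-arc here x≢x = ⊥-elim (x≢x refl)
first-arc (step {y = z} e _) _ = z , e

last-arc : {V : Set} {D : Digraph V} {x y : V} → Reach D x y → x ≢ y → ∃[ z ] D z y ≡ true
last-arc here x≢x = ⊥-elim (x≢x refl)
last-arc {D = D} (step e r) _ = arc-into-end e r
  where
  arc-into-end : ∀ {x y z} → D x y ≡ true → Reach D y z → ∃[ w ] D w z ≡ true
  arc-into-end {x} e here = x , e
  arc-into-end _ (step e r) = arc-into-end e r

strong⇒connected : ∀ {t} {T : Digraph (Fin t)} → Strong T → ∀ i p → Reach T i p
strong⇒connected strong i p with i ≟ p
... | yes refl = here
... | no i≢p = strong i p i≢p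

cut-crossing : {V : Set} {D : Digraph V} (P : V → Bool) → ∀ {x y} → Reach D x y → P x ≡ true → P y ≡ false →
  ∃[ u ] ∃[ v ] P u ≡ true × P v ≡ false × D u v ≡ true
cut-crossing P here Px Py = ⊥-elim (false≢true (trans (sym Py) Px))
cut-crossing P (step {x = x} {y = w} x→w w⇝y) Px Py with P w in Pw
... | true = cut-crossing P w⇝y Pw Py
... | false = x , w , Px , Pw , x→w

module _ {t : ℕ} {T : Digraph (Fin t)} {ns : Fin t → ℕ} {H : (i : Fin t) → Digraph (Fin (ns i))} where

  compose-≡ : ∀ {i} (j q : Fin (ns i)) → compose T H (i , j) (i , q) ≡ H i j q
  compose-≡ {i} j q with i ≟ i
  ... | yes refl = refl
  ... | no i≢i = ⊥-elim (i≢i refl)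

  compose-≢ : ∀ {i p} (j : Fin (ns i)) (q : Fin (ns p)) → i ≢ p → compose T H (i , j) (p , q) ≡ T i p
  compose-≢ {i} {p} j q i≢p with i ≟ p
  ... | yes refl = ⊥-elim (i≢p refl)
  ... | no _ = refl

mk≅ : {V W : Set} {D : Digraph V} {E : Digraph W} (to : V → W) (from : W → V) →
  (∀ y → to (from y) ≡ y) → (∀ x → from (to x) ≡ x) →
  (∀ x y → D x y ≡ E (to x) (to y)) → D ≅ E
mk≅ to from to∘from from∘to arcs = ↔⇒⤖ (mk↔ₛ′ to from to∘from from∘to) , arcs

module ≅-Inverse {V W : Set} {D : Digraph V} {E : Digraph W} (iso : D ≅ E) where
  open Inverse (⤖⇒↔ (proj₁ iso)) public
    using (to; from) renaming (strictlyInverseˡ to to∘from; strictlyInverseʳ to from∘to)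

  arcs : ∀ x y → D x y ≡ E (to x) (to y)
  arcs = proj₂ iso

  from-arcs : ∀ x y → E x y ≡ D (from x) (from y)
  from-arcs x y = sym (trans (arcs (from x) (from y)) (cong₂ E (to∘from x) (to∘from y)))

  to-injective : ∀ {x y} → to x ≡ to y → x ≡ y
  to-injective {x} {y} e = trans (sym (from∘to x)) (trans (cong from e) (from∘to y))

≅-refl : {V : Set} {D : Digraph V} → D ≅ D
≅-refl {D = D} = mk≅ {D = D} {E = D} id id (λ _ → refl) (λ _ → refl) (λ _ _ → refl)

≅-sym : {V W : Set} {D : Digraph V} {E : Digraph W} → D ≅ E → E ≅ D
≅-sym {D = D} {E = E} iso = mk≅ {D = E} {E = D} from to from∘to to∘from from-arcs
  where open ≅-Inverse {D = D} {E = E} iso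

≅-trans : {U V W : Set} {D : Digraph U} {E : Digraph V} {F : Digraph W} → D ≅ E → E ≅ F → D ≅ F
≅-trans {D = D} {E = E} {F = F} iso₁ iso₂ = mk≅ {D = D} {E = F} (I₂.to ∘′ I₁.to) (I₁.from ∘′ I₂.from)
  (λ z → trans (cong I₂.to (I₁.to∘from _)) (I₂.to∘from z))
  (λ x → trans (cong I₁.from (I₂.from∘to _)) (I₁.from∘to x))
  (λ x y → trans (I₁.arcs x y) (I₂.arcs _ _))
  where
  module I₁ = ≅-Inverse {D = D} {E = E} iso₁
  module I₂ = ≅-Inverse {D = E} {E = F} iso₂

HasGoodDecomposition-resp-≅ : {V W : Set} {D : Digraph V} {E : Digraph W} → D ≅ E →
  HasGoodDecomposition D → HasGoodDecomposition E
HasGoodDecomposition-resp-≅ {V} {W} {D} {E} iso (A₁ , A₂ , A₁⊆D , A₂⊆D , disjoint , strong₁ , strong₂) =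
  push A₁ , push A₂ , push-⊆ A₁ A₁⊆D , push-⊆ A₂ A₂⊆D , (λ x y → disjoint (from x) (from y)) ,
  push-strong A₁ strong₁ , push-strong A₂ strong₂
  where
  open ≅-Inverse {D = D} {E = E} iso

  push : Digraph V → Digraph W
  push A x y = A (from x) (from y)

  push-⊆ : ∀ A → A ⊆A D → push A ⊆A E
  push-⊆ A A⊆D x y e = trans (from-arcs x y) (A⊆D (from x) (from y) e)

  push-strong : ∀ A → Strong A → Strong (push A)
  push-strong A strong x y x≢y = subst₂ (Reach (push A)) (to∘from x) (to∘from y)
    (Reach-map to (λ {u} {v} e → subst₂ (λ u′ v′ → A u′ v′ ≡ true) (sym (from∘to u)) (sym (from∘to v)) e)
      (strong (from x) (from y) λ e → x≢y (trans (sym (to∘from x)) (trans (cong to e) (to∘from y)))))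

Σ-≡-subst : {A : Set} (B : A → Set) {a b : A} (e : a ≡ b) (x : B b) → _≡_ {A = Σ A B} (a , subst B (sym e) x) (b , x)
Σ-≡-subst B refl x = refl

compose-≅ : ∀ {t s} {T : Digraph (Fin t)} {T′ : Digraph (Fin s)} {ns : Fin t → ℕ} {ns′ : Fin s → ℕ}
  {H : (i : Fin t) → Digraph (Fin (ns i))} {H′ : (p : Fin s) → Digraph (Fin (ns′ p))} →
  (f : T ≅ T′) → (∀ i → H i ≅ H′ (Bijection.to (proj₁ f) i)) → compose T H ≅ compose T′ H′
compose-≅ {T = T} {T′} {ns} {ns′} {H} {H′} f g =
  mk≅ {D = compose T H} {E = compose T′ H′} to from to∘from from∘to arcs
  where
  module F = ≅-Inverse {D = T} {E = T′} f
  module G (i : Fin _) = ≅-Inverse {D = H i} {E = H′ (F.to i)} (g i)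

  to : Σ (Fin _) (Fin ∘′ ns) → Σ (Fin _) (Fin ∘′ ns′)
  to (i , j) = F.to i , G.to i j

  from : Σ (Fin _) (Fin ∘′ ns′) → Σ (Fin _) (Fin ∘′ ns)
  from (p , k) = F.from p , G.from (F.from p) (subst (Fin ∘′ ns′) (sym (F.to∘from p)) k)

  to∘from : ∀ y → to (from y) ≡ y
  to∘from (p , k) =
    trans (cong (F.to (F.from p) ,_) (G.to∘from (F.from p) _)) (Σ-≡-subst (Fin ∘′ ns′) (F.to∘from p) k)

  from∘to : ∀ x → from (to x) ≡ x
  from∘to (i , j) = back (F.from∘to i) (F.to∘from (F.to i))
    where
    back : ∀ {i′} (e : i′ ≡ i) (d : F.to i′ ≡ F.to i) →
      _≡_ {A = Σ (Fin _) (Fin ∘′ ns)} (i′ , G.from i′ (subst (Fin ∘′ ns′) (sym d) (G.to i j))) (i , j)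
    back refl refl = cong (i ,_) (G.from∘to i j)

  arcs : ∀ x y → compose T H x y ≡ compose T′ H′ (to x) (to y)
  arcs (i , j) (i′ , j′) = by-cases (i ≟ i′)
    where
    by-cases : Dec (i ≡ i′) → compose T H (i , j) (i′ , j′) ≡ compose T′ H′ (to (i , j)) (to (i′ , j′))
    by-cases (yes refl) = trans (compose-≡ {T = T} {H = H} j j′)
      (trans (G.arcs i j j′) (sym (compose-≡ {T = T′} {H = H′} (G.to i j) (G.to i j′))))
    by-cases (no i≢i′) = trans (compose-≢ {T = T} {H = H} j j′ i≢i′)
      (trans (F.arcs i i′) (sym (compose-≢ {T = T′} {H = H′} (G.to i j) (G.to i′ j′) (i≢i′ ∘′ F.to-injective))))

-- Strong spanning subdigraphs pulled back along a retraction

module Absorption {V W : Set} (Q : Digraph V) (κ : V → W) (ρ : W → V) (κ∘ρ : ∀ w → κ (ρ w) ≡ w) where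

  record Skeleton (D : Digraph W) : Set where
    field
      arcs-lift : ∀ u v → D u v ≡ true → Q (ρ u) (ρ v) ≡ true
      out-arc : ∀ x → ∃[ w ] D (κ x) w ≡ true × Q x (ρ w) ≡ true
      in-arc : ∀ x → ∃[ w ] D w (κ x) ≡ true × Q (ρ w) x ≡ true
      connected : ∀ u v → Reach D u v

  pullback : Digraph W → Digraph V
  pullback D x y = D (κ x) (κ y) ∧ Q x y

  pullback-⊆ : (D : Digraph W) → pullback D ⊆A Q
  pullback-⊆ D x y = ∧-conicalʳ (D (κ x) (κ y)) (Q x y)

  pullback-strong : {D : Digraph W} → Skeleton D → Strong (pullback D)
  pullback-strong {D} skeleton x y _ with out-arc x | in-arc y
    where open Skeleton skeleton
  ... | w₁ , x→w₁ , Qx→w₁ | w₂ , w₂→y , Qw₂→y =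
    step (cong₂ _∧_ (subst (λ w → D (κ x) w ≡ true) (sym (κ∘ρ w₁)) x→w₁) Qx→w₁)
      (Reach-map ρ lift (connected w₁ w₂) ◅◅
       step (cong₂ _∧_ (subst (λ w → D w (κ y) ≡ true) (sym (κ∘ρ w₂)) w₂→y) Qw₂→y) here)
    where
    open Skeleton skeleton
    lift : ∀ {u v} → D u v ≡ true → pullback D (ρ u) (ρ v) ≡ true
    lift {u} {v} e = cong₂ _∧_ (subst₂ (λ u′ v′ → D u′ v′ ≡ true) (sym (κ∘ρ u)) (sym (κ∘ρ v)) e) (arcs-lift u v e)

  skeletons⇒HasGoodDecomposition : {D₁ D₂ : Digraph W} → Skeleton D₁ → Skeleton D₂ →
    (∀ u v → ¬ (D₁ u v ≡ true × D₂ u v ≡ true)) → HasGoodDecomposition Q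
  skeletons⇒HasGoodDecomposition {D₁} {D₂} skeleton₁ skeleton₂ disjoint =
    pullback D₁ , pullback D₂ , pullback-⊆ D₁ , pullback-⊆ D₂ ,
    (λ x y (e₁ , e₂) → disjoint (κ x) (κ y) (∧-conicalˡ _ (Q x y) e₁ , ∧-conicalˡ _ (Q x y) e₂)) ,
    pullback-strong skeleton₁ , pullback-strong skeleton₂

-- Voltage lifts

other-vertex : ∀ {t} → 2 ≤ t → (i : Fin t) → ∃[ k ] i ≢ k
other-vertex (s≤s (s≤s _)) 0F = 1F , λ ()
other-vertex (s≤s (s≤s _)) (Fin.suc i) = 0F , λ ()

pick : ∀ {n} → 2 ≤ n → Bool → Fin n
pick (s≤s (s≤s _)) false = 0F
pick (s≤s (s≤s _)) true = 1F

is-1F : ∀ {n} → Fin n → Bool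
is-1F 1F = true
is-1F _ = false

is-1F-pick : ∀ {n} (n≥2 : 2 ≤ n) b → is-1F (pick n≥2 b) ≡ b
is-1F-pick (s≤s (s≤s _)) false = refl
is-1F-pick (s≤s (s≤s _)) true = refl

xnor-self : ∀ a → not (a xor a) ≡ true
xnor-self true = refl
xnor-self false = refl

xnor-cancel : ∀ a c → not (a xor ((a xor c) xor c)) ≡ true
xnor-cancel true true = refl
xnor-cancel true false = refl
xnor-cancel false true = refl
xnor-cancel false false = refl

xnor-negate : ∀ a b c → not (not b xor (not a xor c)) ≡ not (b xor (a xor c))
xnor-negate true true true = refl
xnor-negate true true false = refl
xnor-negate true false true = refl
xnor-negate true false false = refl
xnor-negate false true true = refl
xnor-negate false true false = refl
xnor-negate false false true = refl
xnor-negate false false false = refl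

xnor-exclusive : ∀ a b c → not (b xor (a xor c)) ≡ true → not (b xor (a xor not c)) ≡ false
xnor-exclusive true true true ()
xnor-exclusive true true false _ = refl
xnor-exclusive true false true _ = refl
xnor-exclusive true false false ()
xnor-exclusive false true true _ = refl
xnor-exclusive false true false ()
xnor-exclusive false false true ()
xnor-exclusive false false false _ = refl

record FourCycle {t : ℕ} (T : Digraph (Fin t)) : Set where
  field
    v₁ v₂ v₃ v₄ : Fin t
    v₁→v₂ : T v₁ v₂ ≡ true
    v₂→v₃ : T v₂ v₃ ≡ true
    v₃→v₄ : T v₃ v₄ ≡ true
    v₄→v₁ : T v₄ v₁ ≡ true
    v₃≢v₁ : v₃ ≢ v₁

module VoltageLift {t : ℕ} (T : Digraph (Fin t)) (T-loopless : Loopless T) (T-strong : Strong T) (t≥2 : 2 ≤ t)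
  {ns : Fin t → ℕ} (ns≥2 : ∀ i → 2 ≤ ns i) (H : (i : Fin t) → Digraph (Fin (ns i))) where

  Voltage : Set
  Voltage = Fin t → Fin t → Bool

  lift : Voltage → Digraph (Fin t × Bool)
  lift c (i , a) (p , b) = T i p ∧ not (b xor (a xor c i p))

  T-arc⇒≢ : ∀ {i p} → T i p ≡ true → i ≢ p
  T-arc⇒≢ = arc⇒≢ {D = T} T-loopless

  out-neighbour : ∀ i → ∃[ p ] T i p ≡ true
  out-neighbour i with other-vertex t≥2 i
  ... | k , i≢k = first-arc (T-strong i k i≢k) i≢k

  in-neighbour : ∀ i → ∃[ p ] T p i ≡ true
  in-neighbour i with other-vertex t≥2 i
  ... | k , i≢k = last-arc (T-strong k i (i≢k ∘ sym)) (i≢k ∘ sym)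

  module _ (c : Voltage) where

    lift-step : ∀ {i p a z} → T i p ≡ true → Reach (lift c) (p , a xor c i p) z → Reach (lift c) (i , a) z
    lift-step {i} {p} {a} e r = step (cong₂ _∧_ e (xnor-self (a xor c i p))) r

    lift-walk : ∀ {i p} → Reach T i p → ∀ a → ∃[ b ] Reach (lift c) (i , a) (p , b)
    lift-walk here a = a , here
    lift-walk (step e r) a with lift-walk r _
    ... | b , r′ = b , lift-step e r′

    lift-negate : ∀ {i a p b} → Reach (lift c) (i , a) (p , b) → Reach (lift c) (i , not a) (p , not b)
    lift-negate here = here
    lift-negate {i} {a} (step {y = k , m} e r) =
      step (trans (cong (T i k ∧_) (xnor-negate a m (c i k))) e) (lift-negate r)

    lift-connected : ∀ w → Reach (lift c) (w , false) (w , true) → ∀ u v → Reach (lift c) u v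
    lift-connected w sheet-change (i , a) (p , b) with lift-walk (strong⇒connected T-strong i w) a
    ... | a′ , i⇝w with lift-walk (strong⇒connected T-strong w p) a′
    ... | b′ , w⇝p with b′ Bool.≟ b
    ... | yes refl = i⇝w ◅◅ w⇝p
    ... | no b′≢b = i⇝w ◅◅ (change-sheet a′ ◅◅
      subst (λ z → Reach (lift c) (w , not a′) (p , z)) (sym (¬-not (b′≢b ∘ sym))) (lift-negate w⇝p))
      where
      change-sheet : ∀ x → Reach (lift c) (w , x) (w , not x)
      change-sheet false = sheet-change
      change-sheet true = lift-negate sheet-change

  κ : Σ (Fin t) (λ i → Fin (ns i)) → Fin t × Bool
  κ (i , j) = i , is-1F j

  ρ : Fin t × Bool → Σ (Fin t) (λ i → Fin (ns i))
  ρ (i , a) = i , pick (ns≥2 i) a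

  open Absorption (compose T H) κ ρ (λ (i , a) → cong (i ,_) (is-1F-pick (ns≥2 i) a))

  blob-arc : ∀ {i p} (j : Fin (ns i)) (q : Fin (ns p)) → T i p ≡ true → compose T H (i , j) (p , q) ≡ true
  blob-arc j q e = trans (compose-≢ {T = T} {H = H} j q (T-arc⇒≢ e)) e

  lift-skeleton : (c : Voltage) (w : Fin t) → Reach (lift c) (w , false) (w , true) → Skeleton (lift c)
  lift-skeleton c w sheet-change = record
    { arcs-lift = λ u v e → blob-arc _ _ (∧-conicalˡ _ _ e)
    ; out-arc = out-arc
    ; in-arc = in-arc
    ; connected = lift-connected c w sheet-change
    }
    where
    out-arc : ∀ x → ∃[ w ] lift c (κ x) w ≡ true × compose T H x (ρ w) ≡ true
    out-arc (i , j) with out-neighbour i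
    ... | p , e = (p , is-1F j xor c i p) , cong₂ _∧_ e (xnor-self (is-1F j xor c i p)) , blob-arc _ _ e
    in-arc : ∀ x → ∃[ w ] lift c w (κ x) ≡ true × compose T H (ρ w) x ≡ true
    in-arc (i , j) with in-neighbour i
    ... | p , e = (p , is-1F j xor c p i) , cong₂ _∧_ e (xnor-cancel (is-1F j) (c p i)) , blob-arc _ _ e

  complementary-voltages⇒HasGoodDecomposition : (c : Voltage) →
    ∀ w₁ → Reach (lift c) (w₁ , false) (w₁ , true) →
    ∀ w₂ → Reach (lift (λ i p → not (c i p))) (w₂ , false) (w₂ , true) → HasGoodDecomposition (compose T H)
  complementary-voltages⇒HasGoodDecomposition c w₁ change₁ w₂ change₂ =
    skeletons⇒HasGoodDecomposition (lift-skeleton c w₁ change₁) (lift-skeleton _ w₂ change₂) disjoint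
    where
    disjoint : ∀ u v → ¬ (lift c u v ≡ true × lift (λ i p → not (c i p)) u v ≡ true)
    disjoint (i , a) (p , b) (e₁ , e₂) = false≢true (trans (sym
      (trans (cong (T i p ∧_) (xnor-exclusive a b (c i p) (∧-conicalʳ _ _ e₁))) (∧-zeroʳ (T i p)))) e₂)

  voltage-step : (c : Voltage) → ∀ {i p a k z} → T i p ≡ true → c i p ≡ k →
    Reach (lift c) (p , a xor k) z → Reach (lift c) (i , a) z
  voltage-step c e refl r = lift-step c e r

  module ArcVoltage (v₁ v₂ : Fin t) where

    arc-voltage : Voltage
    arc-voltage i p = does (i ≟ v₁) ∧ does (p ≟ v₂)

    on-arc : arc-voltage v₁ v₂ ≡ true
    on-arc rewrite dec-true (v₁ ≟ v₁) refl | dec-true (v₂ ≟ v₂) refl = refl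

    off-arc : ∀ {i} p → i ≢ v₁ → arc-voltage i p ≡ false
    off-arc {i} p i≢v₁ rewrite dec-false (i ≟ v₁) i≢v₁ = refl

  digon⇒HasGoodDecomposition : ∀ v₁ v₂ → T v₁ v₂ ≡ true → T v₂ v₁ ≡ true → HasGoodDecomposition (compose T H)
  digon⇒HasGoodDecomposition v₁ v₂ e₁₂ e₂₁ = complementary-voltages⇒HasGoodDecomposition arc-voltage
    v₁ (voltage-step arc-voltage e₁₂ on-arc (voltage-step arc-voltage e₂₁ (off-arc v₁ (T-arc⇒≢ e₂₁)) here))
    v₁ (voltage-step _ e₁₂ (cong not on-arc) (voltage-step _ e₂₁ (cong not (off-arc v₁ (T-arc⇒≢ e₂₁))) here))
    where open ArcVoltage v₁ v₂

  -- Since v₃ ≢ v₁, the cycle leaves v₁ only through v₁v₂: it has voltage 1 and complementary voltage 3.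
  four-cycle⇒HasGoodDecomposition : FourCycle T → HasGoodDecomposition (compose T H)
  four-cycle⇒HasGoodDecomposition cycle = complementary-voltages⇒HasGoodDecomposition arc-voltage
    v₁ (voltage-step arc-voltage v₁→v₂ on-arc
         (voltage-step arc-voltage v₂→v₃ (off-arc v₃ v₂≢v₁)
         (voltage-step arc-voltage v₃→v₄ (off-arc v₄ v₃≢v₁)
         (voltage-step arc-voltage v₄→v₁ (off-arc v₁ v₄≢v₁) here))))
    v₁ (voltage-step _ v₁→v₂ (cong not on-arc)
         (voltage-step _ v₂→v₃ (cong not (off-arc v₃ v₂≢v₁))
         (voltage-step _ v₃→v₄ (cong not (off-arc v₄ v₃≢v₁))
         (voltage-step _ v₄→v₁ (cong not (off-arc v₁ v₄≢v₁)) here))))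
    where
    open FourCycle cycle
    open ArcVoltage v₁ v₂
    v₂≢v₁ : v₂ ≢ v₁
    v₂≢v₁ = T-arc⇒≢ v₁→v₂ ∘ sym
    v₄≢v₁ : v₄ ≢ v₁
    v₄≢v₁ = T-arc⇒≢ v₄→v₁

-- Strong tournaments

record Triangle {t : ℕ} (T : Digraph (Fin t)) : Set where
  field
    a x y : Fin t
    a→x : T a x ≡ true
    x→y : T x y ≡ true
    y→a : T y a ≡ true

module StrongTournament {t : ℕ} (T : Digraph (Fin t)) (T-loopless : Loopless T) (T-strong : Strong T)
  (T-semicomplete : Semicomplete T) (T-oriented : ∀ u v → T u v ≡ true → T v u ≡ false) where

  T-arc⇒≢ : ∀ {u v} → T u v ≡ true → u ≢ v
  T-arc⇒≢ = arc⇒≢ {D = T} T-loopless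

  no-digon : ∀ {u v} → T u v ≡ true → T v u ≡ true → ⊥
  no-digon {u} {v} u→v v→u = false≢true (trans (sym (T-oriented u v u→v)) v→u)

  reverse-arc : ∀ {u v} → u ≢ v → T u v ≡ false → T v u ≡ true
  reverse-arc {u} {v} u≢v u↛v with T-semicomplete u v u≢v
  ... | inj₁ u→v = ⊥-elim (false≢true (trans (sym u↛v) u→v))
  ... | inj₂ v→u = v→u

  -- Walk back to a keeping a → u: the first vertex v with v → a closes a triangle.
  triangle-through : ∀ a u → T a u ≡ true → Reach T u a → Triangle T
  triangle-through a u a→u here = ⊥-elim (T-arc⇒≢ a→u refl)
  triangle-through a u a→u (step {y = v} u→v v⇝a) with T v a in v→a
  ... | true = record { a = a ; x = u ; y = v ; a→x = a→u ; x→y = u→v ; y→a = v→a }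
  ... | false with v ≟ a
  ... | yes refl = ⊥-elim (no-digon a→u u→v)
  ... | no v≢a = triangle-through a v (reverse-arc v≢a v→a) v⇝a

  triangle : 2 ≤ t → Triangle T
  triangle (s≤s (s≤s _)) with first-arc (T-strong 0F 1F (λ ())) (λ ())
  ... | u , first→u = triangle-through 0F u first→u (T-strong u 0F (T-arc⇒≢ first→u ∘ sym))

  module _ (tr : Triangle T) where
    open Triangle tr

    OnTriangle : Fin t → Set
    OnTriangle v = v ≡ a ⊎ v ≡ x ⊎ v ≡ y

    onTriangle? : ∀ v → Dec (OnTriangle v)
    onTriangle? v = (v ≟ a) ⊎-dec (v ≟ x) ⊎-dec (v ≟ y)

    Dominated Dominating : Fin t → Set
    Dominated v = T a v ≡ true × T x v ≡ true × T y v ≡ true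
    Dominating v = T v a ≡ true × T v x ≡ true × T v y ≡ true

    classify : ∀ v → ¬ OnTriangle v → FourCycle T ⊎ Dominated v ⊎ Dominating v
    classify v off = by-arcs (T a v) refl (T x v) refl (T y v) refl
      where
      reversed : ∀ {u} → OnTriangle u → T u v ≡ false → T v u ≡ true
      reversed u-on = reverse-arc λ { refl → off u-on }

      by-arcs : ∀ b₁ → T a v ≡ b₁ → ∀ b₂ → T x v ≡ b₂ → ∀ b₃ → T y v ≡ b₃ →
        FourCycle T ⊎ Dominated v ⊎ Dominating v
      by-arcs true a→v true x→v true y→v = inj₂ (inj₁ (a→v , x→v , y→v))
      by-arcs false v→a false v→x false v→y =
        inj₂ (inj₂ (reversed (inj₁ refl) v→a , reversed (inj₂ (inj₁ refl)) v→x , reversed (inj₂ (inj₂ refl)) v→y))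
      by-arcs true a→v false v→x _ _ = inj₁ (record { v₁ = a ; v₂ = v ; v₃ = x ; v₄ = y ; v₁→v₂ = a→v ;
        v₂→v₃ = reversed (inj₂ (inj₁ refl)) v→x ; v₃→v₄ = x→y ; v₄→v₁ = y→a ; v₃≢v₁ = T-arc⇒≢ a→x ∘ sym })
      by-arcs _ _ true x→v false v→y = inj₁ (record { v₁ = x ; v₂ = v ; v₃ = y ; v₄ = a ; v₁→v₂ = x→v ;
        v₂→v₃ = reversed (inj₂ (inj₂ refl)) v→y ; v₃→v₄ = y→a ; v₄→v₁ = a→x ; v₃≢v₁ = T-arc⇒≢ x→y ∘ sym })
      by-arcs false v→a _ _ true y→v = inj₁ (record { v₁ = y ; v₂ = v ; v₃ = a ; v₄ = x ; v₁→v₂ = y→v ;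
        v₂→v₃ = reversed (inj₁ refl) v→a ; v₃→v₄ = a→x ; v₄→v₁ = x→y ; v₃≢v₁ = T-arc⇒≢ y→a ∘ sym })

    dominated-no-arc-to-triangle : ∀ {v w} → Dominated v → OnTriangle w → T v w ≡ true → ⊥
    dominated-no-arc-to-triangle (a→v , _ , _) (inj₁ refl) = no-digon a→v
    dominated-no-arc-to-triangle (_ , x→v , _) (inj₂ (inj₁ refl)) = no-digon x→v
    dominated-no-arc-to-triangle (_ , _ , y→v) (inj₂ (inj₂ refl)) = no-digon y→v

    dominating-no-arc-from-triangle : ∀ {u w} → Dominating w → OnTriangle u → T u w ≡ true → ⊥
    dominating-no-arc-from-triangle (w→a , _ , _) (inj₁ refl) u→w = no-digon u→w w→a
    dominating-no-arc-from-triangle (_ , w→x , _) (inj₂ (inj₁ refl)) u→w = no-digon u→w w→x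
    dominating-no-arc-from-triangle (_ , _ , w→y) (inj₂ (inj₂ refl)) u→w = no-digon u→w w→y

    dominated⇒FourCycle : ∀ {v} → ¬ OnTriangle v → Dominated v → Reach T v a → FourCycle T
    dominated⇒FourCycle off _ here = ⊥-elim (off (inj₁ refl))
    dominated⇒FourCycle {v} off v-dominated (step {y = w} v→w w⇝a) with onTriangle? w
    ... | yes w-on = ⊥-elim (dominated-no-arc-to-triangle v-dominated w-on v→w)
    ... | no w-off with classify w w-off
    ... | inj₁ cycle = cycle
    ... | inj₂ (inj₁ w-dominated) = dominated⇒FourCycle w-off w-dominated w⇝a
    ... | inj₂ (inj₂ (_ , w→x , _)) = record { v₁ = v ; v₂ = w ; v₃ = x ; v₄ = y ; v₁→v₂ = v→w ;
      v₂→v₃ = w→x ; v₃→v₄ = x→y ; v₄→v₁ = proj₂ (proj₂ v-dominated) ;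
      v₃≢v₁ = λ { refl → off (inj₂ (inj₁ refl)) } }

    exit⇒FourCycle : ∀ {u v} → OnTriangle u → ¬ OnTriangle v → Reach T u v → FourCycle T
    exit⇒FourCycle u-on v-off here = ⊥-elim (v-off u-on)
    exit⇒FourCycle u-on v-off (step {y = w} u→w w⇝v) with onTriangle? w
    ... | yes w-on = exit⇒FourCycle w-on v-off w⇝v
    ... | no w-off with classify w w-off
    ... | inj₁ cycle = cycle
    ... | inj₂ (inj₁ w-dominated) = dominated⇒FourCycle w-off w-dominated (T-strong w a λ { refl → w-off (inj₁ refl) })
    ... | inj₂ (inj₂ w-dominating) = ⊥-elim (dominating-no-arc-from-triangle w-dominating u-on u→w)

    spanning-or-FourCycle : (∀ v → OnTriangle v) ⊎ FourCycle T
    spanning-or-FourCycle with any? (λ v → ¬? (onTriangle? v))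
    ... | yes (v , v-off) = inj₂ (exit⇒FourCycle (inj₁ refl) v-off (T-strong a v λ { refl → v-off (inj₁ refl) }))
    ... | no none-off = inj₁ λ v → decidable-stable (onTriangle? v) λ v-off → none-off (v , v-off)

    module Spanning (spanning : ∀ v → OnTriangle v) where

      corner : Fin 3 → Fin t
      corner 0F = a
      corner 1F = x
      corner 2F = y

      position : Fin t → Fin 3
      position v with spanning v
      ... | inj₁ _ = 0F
      ... | inj₂ (inj₁ _) = 1F
      ... | inj₂ (inj₂ _) = 2F

      corner-position : ∀ v → corner (position v) ≡ v
      corner-position v with spanning v
      ... | inj₁ v≡a = sym v≡a
      ... | inj₂ (inj₁ v≡x) = sym v≡x
      ... | inj₂ (inj₂ v≡y) = sym v≡y

      position-corner : ∀ p → position (corner p) ≡ p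
      position-corner 0F with spanning a
      ... | inj₁ _ = refl
      ... | inj₂ (inj₁ a≡x) = ⊥-elim (T-arc⇒≢ a→x a≡x)
      ... | inj₂ (inj₂ a≡y) = ⊥-elim (T-arc⇒≢ y→a (sym a≡y))
      position-corner 1F with spanning x
      ... | inj₁ x≡a = ⊥-elim (T-arc⇒≢ a→x (sym x≡a))
      ... | inj₂ (inj₁ _) = refl
      ... | inj₂ (inj₂ x≡y) = ⊥-elim (T-arc⇒≢ x→y x≡y)
      position-corner 2F with spanning y
      ... | inj₁ y≡a = ⊥-elim (T-arc⇒≢ y→a y≡a)
      ... | inj₂ (inj₁ y≡x) = ⊥-elim (T-arc⇒≢ x→y (sym y≡x))
      ... | inj₂ (inj₂ _) = refl

      C3-arcs : ∀ p q → C3 p q ≡ T (corner p) (corner q)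
      C3-arcs 0F 0F = sym (T-loopless a)
      C3-arcs 0F 1F = sym a→x
      C3-arcs 0F 2F = sym (T-oriented y a y→a)
      C3-arcs 1F 0F = sym (T-oriented a x a→x)
      C3-arcs 1F 1F = sym (T-loopless x)
      C3-arcs 1F 2F = sym x→y
      C3-arcs 2F 0F = sym y→a
      C3-arcs 2F 1F = sym (T-oriented x y x→y)
      C3-arcs 2F 2F = sym (T-loopless y)

      C3≅T : C3 ≅ T
      C3≅T = mk≅ {D = C3} {E = T} corner position corner-position position-corner C3-arcs

  four-cycle-or-C3 : 2 ≤ t → FourCycle T ⊎ C3 ≅ T
  four-cycle-or-C3 t≥2 with spanning-or-FourCycle (triangle t≥2)
  ... | inj₁ spanning = inj₂ (Spanning.C3≅T (triangle t≥2) spanning)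
  ... | inj₂ cycle = inj₁ cycle

-- Blow-ups of the 3-cycle

Vertex : (Fin 3 → ℕ) → Set
Vertex size = Σ (Fin 3) (λ p → Fin (size p))

module _ {size : Fin 3 → ℕ} where

  _≟ᵥ_ : DecidableEquality (Vertex size)
  (p , r) ≟ᵥ (q , s) with p ≟ q
  ... | no p≢q = no λ { refl → p≢q refl }
  ... | yes refl with r ≟ s
  ... | no r≢s = no λ { refl → r≢s refl }
  ... | yes refl = yes refl

  _≟ₐ_ : DecidableEquality (Vertex size × Vertex size)
  _≟ₐ_ = Product.≡-dec _≟ᵥ_ _≟ᵥ_

  all-vertices? : {P : Vertex size → Set} → Decidable P → Dec (∀ v → P v)
  all-vertices? P? = map′ (λ all-p (p , r) → all-p p r) (λ all-v p r → all-v (p , r))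
    (all? λ p → all? λ r → P? (p , r))

  some-vertex? : {P : Vertex size → Set} → Decidable P → Dec (∃ P)
  some-vertex? P? = map′ (λ (p , r , x) → (p , r) , x) (λ ((p , r) , x) → p , r , x)
    (any? λ p → any? λ r → P? (p , r))

module _ {V : Set} where

  Walk : Digraph V → V → List V → V → Set
  Walk D u [] v = u ≡ v
  Walk D u (w ∷ ws) v = D u w ≡ true × Walk D w ws v

  walk? : DecidableEquality V → (D : Digraph V) → ∀ u ws v → Dec (Walk D u ws v)
  walk? _≟_ D u [] v = u ≟ v
  walk? _≟_ D u (w ∷ ws) v = (D u w Bool.≟ true) ×-dec walk? _≟_ D w ws v

  Walk⇒Reach : ∀ {D u v} ws → Walk D u ws v → Reach D u v
  Walk⇒Reach [] refl = here
  Walk⇒Reach (w ∷ ws) (u→w , rest) = step u→w (Walk⇒Reach ws rest)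

  Walk-through : ∀ {D u v x} ws → Walk D u ws v → x ∈ ws → Reach D u x × Reach D x v
  Walk-through (w ∷ ws) (u→w , rest) (here refl) = step u→w here , Walk⇒Reach ws rest
  Walk-through (w ∷ ws) (u→w , rest) (there x∈ws) with Walk-through ws rest x∈ws
  ... | w⇝x , x⇝v = step u→w w⇝x , x⇝v

  closed-spanning-walk⇒connected : ∀ {D} hub ws → Walk D hub ws hub → (∀ v → v ∈ hub ∷ ws) → ∀ u v → Reach D u v
  closed-spanning-walk⇒connected hub ws walk spanning u v = to-hub (spanning u) ◅◅ from-hub (spanning v)
    where
    to-hub : ∀ {x} → x ∈ hub ∷ ws → Reach _ x hub
    to-hub (here refl) = here
    to-hub (there x∈ws) = proj₂ (Walk-through ws walk x∈ws)
    from-hub : ∀ {x} → x ∈ hub ∷ ws → Reach _ hub x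
    from-hub (here refl) = here
    from-hub (there x∈ws) = proj₁ (Walk-through ws walk x∈ws)

record Embedding {m n : ℕ} (D : Digraph (Fin m)) (E : Digraph (Fin n)) : Set where
  field
    embed : Fin m → Fin n
    retract : Fin n → Fin m
    retract-embed : ∀ r → retract (embed r) ≡ r
    embed-arc : ∀ r s → D r s ≡ true → E (embed r) (embed s) ≡ true

injection⇒Embedding : ∀ {m n} {D : Digraph (Fin (suc m))} {E : Digraph (Fin n)} (f : Fin (suc m) → Fin n) →
  (∀ {r s} → f r ≡ f s → r ≡ s) → (∀ r s → D r s ≡ true → E (f r) (f s) ≡ true) → Embedding D E
injection⇒Embedding f f-injective f-arc = record
  { embed = f ; retract = retract ; retract-embed = retract-embed ; embed-arc = f-arc }
  where
  retract : _ → Fin _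
  retract j with any? (λ r → f r ≟ j)
  ... | yes (r , _) = r
  ... | no _ = 0F
  retract-embed : ∀ r → retract (f r) ≡ r
  retract-embed r with any? (λ r′ → f r′ ≟ f r)
  ... | yes (r′ , fr′≡fr) = f-injective fr′≡fr
  ... | no none = ⊥-elim (none (r , refl))

C2 : Digraph (Fin 2)
C2 0F 1F = true
C2 1F 0F = true
C2 _ _ = false

P2+K1 : Digraph (Fin 3)
P2+K1 0F 1F = true
P2+K1 _ _ = false

module _ {n : ℕ} {E : Digraph (Fin n)} where

  Kbar-embedding : ∀ {m} → suc m ≤ n → Embedding (Kbar (suc m)) E
  Kbar-embedding m<n = injection⇒Embedding (λ r → inject≤ r m<n) (inject≤-injective _ _ _ _) λ _ _ ()

  pair : Fin n → Fin n → Fin 2 → Fin n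
  pair u v 0F = u
  pair u v 1F = v

  pair-injective : ∀ {u v} → u ≢ v → ∀ {r s} → pair u v r ≡ pair u v s → r ≡ s
  pair-injective u≢v {0F} {0F} _ = refl
  pair-injective u≢v {0F} {1F} u≡v = ⊥-elim (u≢v u≡v)
  pair-injective u≢v {1F} {0F} v≡u = ⊥-elim (u≢v (sym v≡u))
  pair-injective u≢v {1F} {1F} _ = refl

  P2-embedding : Loopless E → ∀ {u v} → E u v ≡ true → Embedding P2 E
  P2-embedding loopless {u} {v} u→v = injection⇒Embedding (pair u v) (pair-injective (arc⇒≢ {D = E} loopless u→v)) arcs
    where
    arcs : ∀ r s → P2 r s ≡ true → E (pair u v r) (pair u v s) ≡ true
    arcs 0F 1F _ = u→v

  C2-embedding : Loopless E → ∀ {u v} → E u v ≡ true → E v u ≡ true → Embedding C2 E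
  C2-embedding loopless {u} {v} u→v v→u = injection⇒Embedding (pair u v) (pair-injective (arc⇒≢ {D = E} loopless u→v)) arcs
    where
    arcs : ∀ r s → C2 r s ≡ true → E (pair u v r) (pair u v s) ≡ true
    arcs 0F 1F _ = u→v
    arcs 1F 0F _ = v→u

  third : 3 ≤ n → (u v : Fin n) → ∃[ w ] w ≢ u × w ≢ v
  third (s≤s (s≤s (s≤s _))) u v with 0F ≟ u | 0F ≟ v | 1F ≟ u | 1F ≟ v
  ... | no 0≢u | no 0≢v | _ | _ = 0F , 0≢u , 0≢v
  ... | _ | _ | no 1≢u | no 1≢v = 1F , 1≢u , 1≢v
  ... | yes refl | _ | _ | yes refl = 2F , (λ ()) , (λ ())
  ... | _ | yes refl | yes refl | _ = 2F , (λ ()) , (λ ())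
  ... | yes refl | _ | yes () | _
  ... | _ | yes refl | _ | yes ()

  P2+K1-embedding : 3 ≤ n → Loopless E → ∀ {u v} → E u v ≡ true → Embedding P2+K1 E
  P2+K1-embedding n≥3 loopless {u} {v} u→v with third n≥3 u v
  ... | w , w≢u , w≢v = injection⇒Embedding triple triple-injective arcs
    where
    triple : Fin 3 → Fin n
    triple 0F = u
    triple 1F = v
    triple 2F = w
    u≢v : u ≢ v
    u≢v = arc⇒≢ {D = E} loopless u→v
    triple-injective : ∀ {r s} → triple r ≡ triple s → r ≡ s
    triple-injective {0F} {0F} _ = refl
    triple-injective {0F} {1F} e = ⊥-elim (u≢v e)
    triple-injective {0F} {2F} e = ⊥-elim (w≢u (sym e))
    triple-injective {1F} {0F} e = ⊥-elim (u≢v (sym e))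
    triple-injective {1F} {1F} _ = refl
    triple-injective {1F} {2F} e = ⊥-elim (w≢v (sym e))
    triple-injective {2F} {0F} e = ⊥-elim (w≢u e)
    triple-injective {2F} {1F} e = ⊥-elim (w≢v e)
    triple-injective {2F} {2F} _ = refl
    arcs : ∀ r s → P2+K1 r s ≡ true → E (triple r) (triple s) ≡ true
    arcs 0F 1F _ = u→v

C3-loopless : Loopless C3
C3-loopless 0F = refl
C3-loopless 1F = refl
C3-loopless 2F = refl

module _ {size : Fin 3 → ℕ} (inner : (p : Fin 3) → Digraph (Fin (size p))) where

  -- The arcs towards other blobs let further vertices of a larger blob imitate w.
  record Half (D : Digraph (Vertex size)) : Set where
    field
      ⊆blow-up : D ⊆A compose C3 inner
      leaves-blob : ∀ w → ∃[ w′ ] D w w′ ≡ true × C3 (proj₁ w) (proj₁ w′) ≡ true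
      enters-blob : ∀ w → ∃[ w′ ] D w′ w ≡ true × C3 (proj₁ w′) (proj₁ w) ≡ true
      connected : ∀ u v → Reach D u v

  open DecMembership (_≟ᵥ_ {size}) using (_∈?_)

  checked-half : (D : Digraph (Vertex size)) (hub : Vertex size) (walk : List (Vertex size)) →
    {_ : True (all-vertices? λ u → all-vertices? λ v → (D u v Bool.≟ true) →-dec (compose C3 inner u v Bool.≟ true))} →
    {_ : True (all-vertices? λ w → some-vertex? λ w′ →
                 (D w w′ Bool.≟ true) ×-dec (C3 (proj₁ w) (proj₁ w′) Bool.≟ true))} →
    {_ : True (all-vertices? λ w → some-vertex? λ w′ →
                 (D w′ w Bool.≟ true) ×-dec (C3 (proj₁ w′) (proj₁ w) Bool.≟ true))} →
    {_ : True (walk? _≟ᵥ_ D hub walk hub)} → {_ : True (all-vertices? λ v → v ∈? (hub ∷ walk))} →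
    Half D
  checked-half D hub walk {⊆?} {leaves?} {enters?} {closed?} {spanning?} = record
    { ⊆blow-up = toWitness ⊆?
    ; leaves-blob = toWitness leaves?
    ; enters-blob = toWitness enters?
    ; connected = closed-spanning-walk⇒connected hub walk (toWitness closed?) (toWitness spanning?)
    }

record Pattern : Set where
  field
    size : Fin 3 → ℕ
    inner : (p : Fin 3) → Digraph (Fin (size p))
    half₁ half₂ : Digraph (Vertex size)
    half₁-ok : Half inner half₁
    half₂-ok : Half inner half₂
    disjoint : ∀ u v → ¬ (half₁ u v ≡ true × half₂ u v ≡ true)

checked-disjoint : ∀ {size} (D₁ D₂ : Digraph (Vertex size)) →
  {_ : True (all-vertices? λ u → all-vertices? λ v → ¬? ((D₁ u v Bool.≟ true) ×-dec (D₂ u v Bool.≟ true)))} →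
  ∀ u v → ¬ (D₁ u v ≡ true × D₂ u v ≡ true)
checked-disjoint D₁ D₂ {disjoint?} = toWitness disjoint?

module _ (P : Pattern) {n : Fin 3 → ℕ} {H : (p : Fin 3) → Digraph (Fin (n p))} where
  open Pattern P

  pattern⇒HasGoodDecomposition : (∀ p → Embedding (inner p) (H p)) → HasGoodDecomposition (compose C3 H)
  pattern⇒HasGoodDecomposition emb =
    skeletons⇒HasGoodDecomposition (half⇒skeleton half₁-ok) (half⇒skeleton half₂-ok) disjoint
    where
    open module Emb (p : Fin 3) = Embedding (emb p)

    κ : Vertex n → Vertex size
    κ (p , j) = p , retract p j

    ρ : Vertex size → Vertex n
    ρ (p , r) = p , embed p r

    open Absorption (compose C3 H) κ ρ (λ (p , r) → cong (p ,_) (retract-embed p r))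

    C3-arc⇒≢ : ∀ {p q} → C3 p q ≡ true → p ≢ q
    C3-arc⇒≢ = arc⇒≢ {D = C3} C3-loopless

    blob-arc : ∀ {p q} (j : Fin (n p)) (k : Fin (n q)) → C3 p q ≡ true → compose C3 H (p , j) (q , k) ≡ true
    blob-arc j k e = trans (compose-≢ {T = C3} {H = H} j k (C3-arc⇒≢ e)) e

    lift-arc : ∀ u v → compose C3 inner u v ≡ true → compose C3 H (ρ u) (ρ v) ≡ true
    lift-arc (p , r) (q , s) = by-cases (p ≟ q)
      where
      by-cases : Dec (p ≡ q) → compose C3 inner (p , r) (q , s) ≡ true → compose C3 H (ρ (p , r)) (ρ (q , s)) ≡ true
      by-cases (yes refl) e = trans (compose-≡ {T = C3} {H = H} _ _)
        (embed-arc p r s (trans (sym (compose-≡ {T = C3} {H = inner} r s)) e))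
      by-cases (no p≢q) e = trans (compose-≢ {T = C3} {H = H} _ _ p≢q) (trans (sym (compose-≢ {T = C3} {H = inner} r s p≢q)) e)

    half⇒skeleton : ∀ {D} → Half inner D → Skeleton D
    half⇒skeleton {D} half = record
      { arcs-lift = λ u v e → lift-arc u v (⊆blow-up u v e)
      ; out-arc = λ x → let (w , x→w , forward) = leaves-blob (κ x) in w , x→w , blob-arc _ _ forward
      ; in-arc = λ x → let (w , w→x , backward) = enters-blob (κ x) in w , w→x , blob-arc _ _ backward
      ; connected = connected
      }
      where open Half half

module _ {size : Fin 3 → ℕ} where

  infix 8 _∙_
  infix 6 _⟶_

  _∙_ : (p : Fin 3) → Fin (size p) → Vertex size
  _∙_ = _,_

  _⟶_ : Vertex size → Vertex size → Vertex size × Vertex size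
  _⟶_ = _,_

  fromArcs : List (Vertex size × Vertex size) → Digraph (Vertex size)
  fromArcs arcs u v = does (DecMembership._∈?_ _≟ₐ_ (u , v) arcs)

sizes422 sizes332 : Fin 3 → ℕ
sizes422 0F = 4
sizes422 _ = 2
sizes332 2F = 2
sizes332 _ = 3

H-K4K2K2 : (p : Fin 3) → Digraph (Fin (sizes422 p))
H-K4K2K2 p = Kbar (sizes422 p)

H-K3K3K2 : (p : Fin 3) → Digraph (Fin (sizes332 p))
H-K3K3K2 p = Kbar (sizes332 p)

H-C2K2K2 H-P2P2K2 : (p : Fin 3) → Digraph (Fin (sizes222 p))
H-C2K2K2 0F = C2
H-C2K2K2 _ = Kbar 2
H-P2P2K2 2F = Kbar 2
H-P2P2K2 _ = P2

H-P2K2K3 H-K2P2K3 H-K2K2P2+K1 : (p : Fin 3) → Digraph (Fin (sizes223 p))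
H-P2K2K3 0F = P2
H-P2K2K3 1F = Kbar 2
H-P2K2K3 2F = Kbar 3
H-K2P2K3 0F = Kbar 2
H-K2P2K3 1F = P2
H-K2P2K3 2F = Kbar 3
H-K2K2P2+K1 0F = Kbar 2
H-K2K2P2+K1 1F = Kbar 2
H-K2K2P2+K1 2F = P2+K1

-- The halves were found by computer search.
pattern-K4K2K2 : Pattern
pattern-K4K2K2 = record
  { size = sizes422
  ; inner = H-K4K2K2
  ; half₁ = fromArcs half₁
  ; half₂ = fromArcs half₂
  ; half₁-ok = checked-half H-K4K2K2 (fromArcs half₁) (0F ∙ 0F) walk₁
  ; half₂-ok = checked-half H-K4K2K2 (fromArcs half₂) (0F ∙ 0F) walk₂
  ; disjoint = checked-disjoint (fromArcs half₁) (fromArcs half₂)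
  }
  where
  half₁ half₂ : List (Vertex sizes422 × Vertex sizes422)
  half₁ = 0F ∙ 0F ⟶ 1F ∙ 1F ∷ 0F ∙ 1F ⟶ 1F ∙ 0F ∷ 0F ∙ 2F ⟶ 1F ∙ 0F ∷ 0F ∙ 3F ⟶ 1F ∙ 1F ∷
    1F ∙ 0F ⟶ 2F ∙ 0F ∷ 1F ∙ 1F ⟶ 2F ∙ 1F ∷ 2F ∙ 0F ⟶ 0F ∙ 2F ∷ 2F ∙ 0F ⟶ 0F ∙ 3F ∷
    2F ∙ 1F ⟶ 0F ∙ 0F ∷ 2F ∙ 1F ⟶ 0F ∙ 1F ∷ []
  half₂ = 0F ∙ 0F ⟶ 1F ∙ 0F ∷ 0F ∙ 1F ⟶ 1F ∙ 1F ∷ 0F ∙ 2F ⟶ 1F ∙ 1F ∷ 0F ∙ 3F ⟶ 1F ∙ 0F ∷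
    1F ∙ 0F ⟶ 2F ∙ 1F ∷ 1F ∙ 1F ⟶ 2F ∙ 0F ∷ 2F ∙ 0F ⟶ 0F ∙ 0F ∷ 2F ∙ 0F ⟶ 0F ∙ 1F ∷
    2F ∙ 1F ⟶ 0F ∙ 2F ∷ 2F ∙ 1F ⟶ 0F ∙ 3F ∷ []
  walk₁ walk₂ : List (Vertex sizes422)
  walk₁ = 1F ∙ 1F ∷ 2F ∙ 1F ∷ 0F ∙ 1F ∷ 1F ∙ 0F ∷ 2F ∙ 0F ∷ 0F ∙ 2F ∷ 1F ∙ 0F ∷ 2F ∙ 0F ∷
    0F ∙ 3F ∷ 1F ∙ 1F ∷ 2F ∙ 1F ∷ 0F ∙ 0F ∷ []
  walk₂ = 1F ∙ 0F ∷ 2F ∙ 1F ∷ 0F ∙ 2F ∷ 1F ∙ 1F ∷ 2F ∙ 0F ∷ 0F ∙ 1F ∷ 1F ∙ 1F ∷ 2F ∙ 0F ∷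
    0F ∙ 0F ∷ 1F ∙ 0F ∷ 2F ∙ 1F ∷ 0F ∙ 3F ∷ 1F ∙ 0F ∷ 2F ∙ 1F ∷ 0F ∙ 2F ∷ 1F ∙ 1F ∷
    2F ∙ 0F ∷ 0F ∙ 0F ∷ []

pattern-K3K3K2 : Pattern
pattern-K3K3K2 = record
  { size = sizes332
  ; inner = H-K3K3K2
  ; half₁ = fromArcs half₁
  ; half₂ = fromArcs half₂
  ; half₁-ok = checked-half H-K3K3K2 (fromArcs half₁) (0F ∙ 0F) walk₁
  ; half₂-ok = checked-half H-K3K3K2 (fromArcs half₂) (0F ∙ 0F) walk₂
  ; disjoint = checked-disjoint (fromArcs half₁) (fromArcs half₂)
  }
  where
  half₁ half₂ : List (Vertex sizes332 × Vertex sizes332)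
  half₁ = 0F ∙ 0F ⟶ 1F ∙ 0F ∷ 0F ∙ 1F ⟶ 1F ∙ 1F ∷ 0F ∙ 1F ⟶ 1F ∙ 2F ∷ 0F ∙ 2F ⟶ 1F ∙ 1F ∷
    0F ∙ 2F ⟶ 1F ∙ 2F ∷ 1F ∙ 0F ⟶ 2F ∙ 0F ∷ 1F ∙ 1F ⟶ 2F ∙ 0F ∷ 1F ∙ 2F ⟶ 2F ∙ 1F ∷
    2F ∙ 0F ⟶ 0F ∙ 0F ∷ 2F ∙ 0F ⟶ 0F ∙ 1F ∷ 2F ∙ 1F ⟶ 0F ∙ 2F ∷ []
  half₂ = 0F ∙ 0F ⟶ 1F ∙ 1F ∷ 0F ∙ 0F ⟶ 1F ∙ 2F ∷ 0F ∙ 1F ⟶ 1F ∙ 0F ∷ 0F ∙ 2F ⟶ 1F ∙ 0F ∷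
    1F ∙ 0F ⟶ 2F ∙ 1F ∷ 1F ∙ 1F ⟶ 2F ∙ 1F ∷ 1F ∙ 2F ⟶ 2F ∙ 0F ∷ 2F ∙ 0F ⟶ 0F ∙ 2F ∷
    2F ∙ 1F ⟶ 0F ∙ 0F ∷ 2F ∙ 1F ⟶ 0F ∙ 1F ∷ []
  walk₁ walk₂ : List (Vertex sizes332)
  walk₁ = 1F ∙ 0F ∷ 2F ∙ 0F ∷ 0F ∙ 1F ∷ 1F ∙ 1F ∷ 2F ∙ 0F ∷ 0F ∙ 1F ∷ 1F ∙ 2F ∷ 2F ∙ 1F ∷
    0F ∙ 2F ∷ 1F ∙ 1F ∷ 2F ∙ 0F ∷ 0F ∙ 0F ∷ []
  walk₂ = 1F ∙ 1F ∷ 2F ∙ 1F ∷ 0F ∙ 1F ∷ 1F ∙ 0F ∷ 2F ∙ 1F ∷ 0F ∙ 0F ∷ 1F ∙ 2F ∷ 2F ∙ 0F ∷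
    0F ∙ 2F ∷ 1F ∙ 0F ∷ 2F ∙ 1F ∷ 0F ∙ 0F ∷ []

pattern-C2K2K2 : Pattern
pattern-C2K2K2 = record
  { size = sizes222
  ; inner = H-C2K2K2
  ; half₁ = fromArcs half₁
  ; half₂ = fromArcs half₂
  ; half₁-ok = checked-half H-C2K2K2 (fromArcs half₁) (0F ∙ 0F) walk₁
  ; half₂-ok = checked-half H-C2K2K2 (fromArcs half₂) (0F ∙ 0F) walk₂
  ; disjoint = checked-disjoint (fromArcs half₁) (fromArcs half₂)
  }
  where
  half₁ half₂ : List (Vertex sizes222 × Vertex sizes222)
  half₁ = 0F ∙ 0F ⟶ 1F ∙ 1F ∷ 0F ∙ 1F ⟶ 1F ∙ 0F ∷ 1F ∙ 0F ⟶ 2F ∙ 0F ∷ 1F ∙ 1F ⟶ 2F ∙ 1F ∷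
    2F ∙ 0F ⟶ 0F ∙ 0F ∷ 2F ∙ 1F ⟶ 0F ∙ 1F ∷ []
  half₂ = 0F ∙ 0F ⟶ 1F ∙ 0F ∷ 0F ∙ 1F ⟶ 1F ∙ 1F ∷ 1F ∙ 0F ⟶ 2F ∙ 1F ∷ 1F ∙ 1F ⟶ 2F ∙ 0F ∷
    2F ∙ 0F ⟶ 0F ∙ 1F ∷ 2F ∙ 1F ⟶ 0F ∙ 0F ∷ 0F ∙ 0F ⟶ 0F ∙ 1F ∷ 0F ∙ 1F ⟶ 0F ∙ 0F ∷ []
  walk₁ walk₂ : List (Vertex sizes222)
  walk₁ = 1F ∙ 1F ∷ 2F ∙ 1F ∷ 0F ∙ 1F ∷ 1F ∙ 0F ∷ 2F ∙ 0F ∷ 0F ∙ 0F ∷ []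
  walk₂ = 0F ∙ 1F ∷ 1F ∙ 1F ∷ 2F ∙ 0F ∷ 0F ∙ 1F ∷ 0F ∙ 0F ∷ 1F ∙ 0F ∷ 2F ∙ 1F ∷ 0F ∙ 0F ∷ []

pattern-P2P2K2 : Pattern
pattern-P2P2K2 = record
  { size = sizes222
  ; inner = H-P2P2K2
  ; half₁ = fromArcs half₁
  ; half₂ = fromArcs half₂
  ; half₁-ok = checked-half H-P2P2K2 (fromArcs half₁) (0F ∙ 0F) walk₁
  ; half₂-ok = checked-half H-P2P2K2 (fromArcs half₂) (0F ∙ 0F) walk₂
  ; disjoint = checked-disjoint (fromArcs half₁) (fromArcs half₂)
  }
  where
  half₁ half₂ : List (Vertex sizes222 × Vertex sizes222)
  half₁ = 0F ∙ 0F ⟶ 1F ∙ 0F ∷ 0F ∙ 1F ⟶ 1F ∙ 1F ∷ 1F ∙ 0F ⟶ 2F ∙ 1F ∷ 1F ∙ 1F ⟶ 2F ∙ 0F ∷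
    2F ∙ 0F ⟶ 0F ∙ 0F ∷ 2F ∙ 1F ⟶ 0F ∙ 1F ∷ []
  half₂ = 0F ∙ 0F ⟶ 1F ∙ 1F ∷ 0F ∙ 1F ⟶ 1F ∙ 0F ∷ 1F ∙ 0F ⟶ 2F ∙ 0F ∷ 1F ∙ 1F ⟶ 2F ∙ 1F ∷
    2F ∙ 0F ⟶ 0F ∙ 1F ∷ 2F ∙ 1F ⟶ 0F ∙ 0F ∷ 0F ∙ 0F ⟶ 0F ∙ 1F ∷ 1F ∙ 0F ⟶ 1F ∙ 1F ∷ []
  walk₁ walk₂ : List (Vertex sizes222)
  walk₁ = 1F ∙ 0F ∷ 2F ∙ 1F ∷ 0F ∙ 1F ∷ 1F ∙ 1F ∷ 2F ∙ 0F ∷ 0F ∙ 0F ∷ []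
  walk₂ = 0F ∙ 1F ∷ 1F ∙ 0F ∷ 1F ∙ 1F ∷ 2F ∙ 1F ∷ 0F ∙ 0F ∷ 0F ∙ 1F ∷ 1F ∙ 0F ∷ 2F ∙ 0F ∷
    0F ∙ 1F ∷ 1F ∙ 0F ∷ 1F ∙ 1F ∷ 2F ∙ 1F ∷ 0F ∙ 0F ∷ []

pattern-P2K2K3 : Pattern
pattern-P2K2K3 = record
  { size = sizes223
  ; inner = H-P2K2K3
  ; half₁ = fromArcs half₁
  ; half₂ = fromArcs half₂
  ; half₁-ok = checked-half H-P2K2K3 (fromArcs half₁) (0F ∙ 0F) walk₁
  ; half₂-ok = checked-half H-P2K2K3 (fromArcs half₂) (0F ∙ 0F) walk₂
  ; disjoint = checked-disjoint (fromArcs half₁) (fromArcs half₂)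
  }
  where
  half₁ half₂ : List (Vertex sizes223 × Vertex sizes223)
  half₁ = 0F ∙ 0F ⟶ 1F ∙ 1F ∷ 0F ∙ 1F ⟶ 1F ∙ 0F ∷ 1F ∙ 0F ⟶ 2F ∙ 1F ∷ 1F ∙ 0F ⟶ 2F ∙ 2F ∷
    1F ∙ 1F ⟶ 2F ∙ 0F ∷ 2F ∙ 0F ⟶ 0F ∙ 1F ∷ 2F ∙ 1F ⟶ 0F ∙ 1F ∷ 2F ∙ 2F ⟶ 0F ∙ 0F ∷ []
  half₂ = 0F ∙ 0F ⟶ 1F ∙ 0F ∷ 0F ∙ 1F ⟶ 1F ∙ 1F ∷ 1F ∙ 0F ⟶ 2F ∙ 0F ∷ 1F ∙ 1F ⟶ 2F ∙ 1F ∷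
    1F ∙ 1F ⟶ 2F ∙ 2F ∷ 2F ∙ 0F ⟶ 0F ∙ 0F ∷ 2F ∙ 1F ⟶ 0F ∙ 0F ∷ 2F ∙ 2F ⟶ 0F ∙ 1F ∷
    0F ∙ 0F ⟶ 0F ∙ 1F ∷ []
  walk₁ walk₂ : List (Vertex sizes223)
  walk₁ = 1F ∙ 1F ∷ 2F ∙ 0F ∷ 0F ∙ 1F ∷ 1F ∙ 0F ∷ 2F ∙ 1F ∷ 0F ∙ 1F ∷ 1F ∙ 0F ∷ 2F ∙ 2F ∷
    0F ∙ 0F ∷ []
  walk₂ = 0F ∙ 1F ∷ 1F ∙ 1F ∷ 2F ∙ 1F ∷ 0F ∙ 0F ∷ 1F ∙ 0F ∷ 2F ∙ 0F ∷ 0F ∙ 0F ∷ 0F ∙ 1F ∷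
    1F ∙ 1F ∷ 2F ∙ 2F ∷ 0F ∙ 1F ∷ 1F ∙ 1F ∷ 2F ∙ 1F ∷ 0F ∙ 0F ∷ []

pattern-K2P2K3 : Pattern
pattern-K2P2K3 = record
  { size = sizes223
  ; inner = H-K2P2K3
  ; half₁ = fromArcs half₁
  ; half₂ = fromArcs half₂
  ; half₁-ok = checked-half H-K2P2K3 (fromArcs half₁) (0F ∙ 0F) walk₁
  ; half₂-ok = checked-half H-K2P2K3 (fromArcs half₂) (0F ∙ 0F) walk₂
  ; disjoint = checked-disjoint (fromArcs half₁) (fromArcs half₂)
  }
  where
  half₁ half₂ : List (Vertex sizes223 × Vertex sizes223)
  half₁ = 0F ∙ 0F ⟶ 1F ∙ 1F ∷ 0F ∙ 1F ⟶ 1F ∙ 0F ∷ 1F ∙ 0F ⟶ 2F ∙ 1F ∷ 1F ∙ 0F ⟶ 2F ∙ 2F ∷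
    1F ∙ 1F ⟶ 2F ∙ 0F ∷ 2F ∙ 0F ⟶ 0F ∙ 1F ∷ 2F ∙ 1F ⟶ 0F ∙ 1F ∷ 2F ∙ 2F ⟶ 0F ∙ 0F ∷ []
  half₂ = 0F ∙ 0F ⟶ 1F ∙ 0F ∷ 0F ∙ 1F ⟶ 1F ∙ 1F ∷ 1F ∙ 0F ⟶ 2F ∙ 0F ∷ 1F ∙ 1F ⟶ 2F ∙ 1F ∷
    1F ∙ 1F ⟶ 2F ∙ 2F ∷ 2F ∙ 0F ⟶ 0F ∙ 0F ∷ 2F ∙ 1F ⟶ 0F ∙ 0F ∷ 2F ∙ 2F ⟶ 0F ∙ 1F ∷
    1F ∙ 0F ⟶ 1F ∙ 1F ∷ []
  walk₁ walk₂ : List (Vertex sizes223)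
  walk₁ = 1F ∙ 1F ∷ 2F ∙ 0F ∷ 0F ∙ 1F ∷ 1F ∙ 0F ∷ 2F ∙ 1F ∷ 0F ∙ 1F ∷ 1F ∙ 0F ∷ 2F ∙ 2F ∷
    0F ∙ 0F ∷ []
  walk₂ = 1F ∙ 0F ∷ 1F ∙ 1F ∷ 2F ∙ 1F ∷ 0F ∙ 0F ∷ 1F ∙ 0F ∷ 2F ∙ 0F ∷ 0F ∙ 0F ∷ 1F ∙ 0F ∷
    1F ∙ 1F ∷ 2F ∙ 2F ∷ 0F ∙ 1F ∷ 1F ∙ 1F ∷ 2F ∙ 1F ∷ 0F ∙ 0F ∷ []

pattern-K2K2P2+K1 : Pattern
pattern-K2K2P2+K1 = record
  { size = sizes223
  ; inner = H-K2K2P2+K1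
  ; half₁ = fromArcs half₁
  ; half₂ = fromArcs half₂
  ; half₁-ok = checked-half H-K2K2P2+K1 (fromArcs half₁) (0F ∙ 0F) walk₁
  ; half₂-ok = checked-half H-K2K2P2+K1 (fromArcs half₂) (0F ∙ 0F) walk₂
  ; disjoint = checked-disjoint (fromArcs half₁) (fromArcs half₂)
  }
  where
  half₁ half₂ : List (Vertex sizes223 × Vertex sizes223)
  half₁ = 0F ∙ 0F ⟶ 1F ∙ 0F ∷ 0F ∙ 1F ⟶ 1F ∙ 1F ∷ 1F ∙ 0F ⟶ 2F ∙ 0F ∷ 1F ∙ 1F ⟶ 2F ∙ 1F ∷
    1F ∙ 1F ⟶ 2F ∙ 2F ∷ 2F ∙ 0F ⟶ 0F ∙ 1F ∷ 2F ∙ 1F ⟶ 0F ∙ 0F ∷ 2F ∙ 2F ⟶ 0F ∙ 1F ∷ []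
  half₂ = 0F ∙ 0F ⟶ 1F ∙ 1F ∷ 0F ∙ 1F ⟶ 1F ∙ 0F ∷ 1F ∙ 0F ⟶ 2F ∙ 1F ∷ 1F ∙ 0F ⟶ 2F ∙ 2F ∷
    1F ∙ 1F ⟶ 2F ∙ 0F ∷ 2F ∙ 0F ⟶ 0F ∙ 0F ∷ 2F ∙ 1F ⟶ 0F ∙ 1F ∷ 2F ∙ 2F ⟶ 0F ∙ 0F ∷
    2F ∙ 0F ⟶ 2F ∙ 1F ∷ []
  walk₁ walk₂ : List (Vertex sizes223)
  walk₁ = 1F ∙ 0F ∷ 2F ∙ 0F ∷ 0F ∙ 1F ∷ 1F ∙ 1F ∷ 2F ∙ 1F ∷ 0F ∙ 0F ∷ 1F ∙ 0F ∷ 2F ∙ 0F ∷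
    0F ∙ 1F ∷ 1F ∙ 1F ∷ 2F ∙ 2F ∷ 0F ∙ 1F ∷ 1F ∙ 1F ∷ 2F ∙ 1F ∷ 0F ∙ 0F ∷ []
  walk₂ = 1F ∙ 1F ∷ 2F ∙ 0F ∷ 2F ∙ 1F ∷ 0F ∙ 1F ∷ 1F ∙ 0F ∷ 2F ∙ 2F ∷ 0F ∙ 0F ∷ []

Exceptional : {V : Set} → Digraph V → Set
Exceptional D = D ≅ Exc1 ⊎ D ≅ Exc2 ⊎ D ≅ Exc3

GoodOrExceptional : {V : Set} → Digraph V → Set
GoodOrExceptional D = HasGoodDecomposition D ⊎ Exceptional D

GoodOrExceptional-resp-≅ : {V W : Set} {D : Digraph V} {E : Digraph W} → D ≅ E →
  GoodOrExceptional D → GoodOrExceptional E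
GoodOrExceptional-resp-≅ {D = D} {E = E} iso =
  Sum.map (HasGoodDecomposition-resp-≅ iso) (Sum.map (via {F = Exc1}) (Sum.map (via {F = Exc2}) (via {F = Exc3})))
  where
  via : {U : Set} {F : Digraph U} → D ≅ F → E ≅ F
  via {F = F} = ≅-trans {D = E} {E = D} {F = F} (≅-sym {D = D} {E = E} iso)

rotate : Fin 3 → Fin 3
rotate 0F = 1F
rotate 1F = 2F
rotate 2F = 0F

C3-rotation : C3 ≅ C3
C3-rotation = mk≅ {D = C3} {E = C3} rotate (rotate ∘ rotate) rotate³ rotate³ arcs
  where
  rotate³ : ∀ p → rotate (rotate (rotate p)) ≡ p
  rotate³ 0F = refl
  rotate³ 1F = refl
  rotate³ 2F = refl
  arcs : ∀ p q → C3 p q ≡ C3 (rotate p) (rotate q)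
  arcs 0F 0F = refl
  arcs 0F 1F = refl
  arcs 0F 2F = refl
  arcs 1F 0F = refl
  arcs 1F 1F = refl
  arcs 1F 2F = refl
  arcs 2F 0F = refl
  arcs 2F 1F = refl
  arcs 2F 2F = refl

size-class : ∀ {k} → 2 ≤ k → k ≡ 2 ⊎ k ≡ 3 ⊎ 4 ≤ k
size-class {2} _ = inj₁ refl
size-class {1} (s≤s ())
size-class {3} _ = inj₂ (inj₁ refl)
size-class {suc (suc (suc (suc _)))} _ = inj₂ (inj₂ (s≤s (s≤s (s≤s (s≤s z≤n)))))

find-arc : ∀ {k} (D : Digraph (Fin k)) → (∃[ u ] ∃[ v ] D u v ≡ true) ⊎ (∀ u v → D u v ≡ false)
find-arc D with any? (λ u → any? (λ v → D u v Bool.≟ true))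
... | yes found = inj₁ found
... | no none = inj₂ λ u v → ¬-not λ u→v → none (u , v , u→v)

Kbar-≅ : ∀ {k m} {D : Digraph (Fin k)} → k ≡ m → (∀ u v → D u v ≡ false) → D ≅ Kbar m
Kbar-≅ {D = D} refl arcless = mk≅ {D = D} {E = Kbar _} (λ u → u) (λ u → u) (λ _ → refl) (λ _ → refl) arcless

P2-≅ : ∀ {k} {D : Digraph (Fin k)} → k ≡ 2 → Loopless D → ∀ {u v} → D u v ≡ true → D v u ≡ false → D ≅ P2
P2-≅ {D = D} refl loopless {0F} {1F} u→v v↛u = mk≅ {D = D} {E = P2} (λ u → u) (λ u → u) (λ _ → refl) (λ _ → refl) arcs
  where
  arcs : ∀ x y → D x y ≡ P2 x y
  arcs 0F 0F = loopless 0F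
  arcs 0F 1F = u→v
  arcs 1F 0F = v↛u
  arcs 1F 1F = loopless 1F
P2-≅ {D = D} refl loopless {1F} {0F} u→v v↛u = mk≅ {D = D} {E = P2} swap swap swap² swap² arcs
  where
  swap : Fin 2 → Fin 2
  swap 0F = 1F
  swap 1F = 0F
  swap² : ∀ x → swap (swap x) ≡ x
  swap² 0F = refl
  swap² 1F = refl
  arcs : ∀ x y → D x y ≡ P2 (swap x) (swap y)
  arcs 0F 0F = loopless 0F
  arcs 0F 1F = v↛u
  arcs 1F 0F = u→v
  arcs 1F 1F = loopless 1F
P2-≅ {D = D} refl loopless {0F} {0F} u→u _ = ⊥-elim (arc⇒≢ {D = D} loopless u→u refl)
P2-≅ {D = D} refl loopless {1F} {1F} u→u _ = ⊥-elim (arc⇒≢ {D = D} loopless u→u refl)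

record BlowUpOfC3 : Set where
  field
    n : Fin 3 → ℕ
    H : (p : Fin 3) → Digraph (Fin (n p))
    H-loopless : ∀ p → Loopless (H p)
    n≥2 : ∀ p → 2 ≤ n p

  Q : Digraph (Vertex n)
  Q = compose C3 H

  Arcless : Fin 3 → Set
  Arcless p = ∀ u v → H p u v ≡ false

rotate-blobs : BlowUpOfC3 → BlowUpOfC3
rotate-blobs B = record { n = n ∘ rotate ; H = H ∘ rotate ; H-loopless = H-loopless ∘ rotate ; n≥2 = n≥2 ∘ rotate }
  where open BlowUpOfC3 B

rotated : ∀ B → GoodOrExceptional (BlowUpOfC3.Q (rotate-blobs B)) → GoodOrExceptional (BlowUpOfC3.Q B)
rotated B = GoodOrExceptional-resp-≅ (compose-≅ C3-rotation λ _ → ≅-refl)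

rotated² : ∀ B → GoodOrExceptional (BlowUpOfC3.Q (rotate-blobs (rotate-blobs B))) → GoodOrExceptional (BlowUpOfC3.Q B)
rotated² B = rotated B ∘ rotated (rotate-blobs B)

module Configurations (B : BlowUpOfC3) where
  open BlowUpOfC3 B

  big-blob : 4 ≤ n 0F → HasGoodDecomposition Q
  big-blob n₀≥4 = pattern⇒HasGoodDecomposition pattern-K4K2K2 λ
    { 0F → Kbar-embedding n₀≥4 ; 1F → Kbar-embedding (n≥2 1F) ; 2F → Kbar-embedding (n≥2 2F) }

  two-medium-blobs : 3 ≤ n 0F → 3 ≤ n 1F → HasGoodDecomposition Q
  two-medium-blobs n₀≥3 n₁≥3 = pattern⇒HasGoodDecomposition pattern-K3K3K2 λ
    { 0F → Kbar-embedding n₀≥3 ; 1F → Kbar-embedding n₁≥3 ; 2F → Kbar-embedding (n≥2 2F) }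

  digon-in-blob₀ : ∀ {u v} → H 0F u v ≡ true → H 0F v u ≡ true → HasGoodDecomposition Q
  digon-in-blob₀ u→v v→u = pattern⇒HasGoodDecomposition pattern-C2K2K2 λ
    { 0F → C2-embedding (H-loopless 0F) u→v v→u ; 1F → Kbar-embedding (n≥2 1F) ; 2F → Kbar-embedding (n≥2 2F) }

  arcs-in-blobs₀₁ : ∀ {u v u′ v′} → H 0F u v ≡ true → H 1F u′ v′ ≡ true → HasGoodDecomposition Q
  arcs-in-blobs₀₁ u→v u′→v′ = pattern⇒HasGoodDecomposition pattern-P2P2K2 λ
    { 0F → P2-embedding (H-loopless 0F) u→v ; 1F → P2-embedding (H-loopless 1F) u′→v′ ; 2F → Kbar-embedding (n≥2 2F) }

  module _ (n₂≥3 : 3 ≤ n 2F) where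

    arc-in-blob₀ : ∀ {u v} → H 0F u v ≡ true → HasGoodDecomposition Q
    arc-in-blob₀ u→v = pattern⇒HasGoodDecomposition pattern-P2K2K3 λ
      { 0F → P2-embedding (H-loopless 0F) u→v ; 1F → Kbar-embedding (n≥2 1F) ; 2F → Kbar-embedding n₂≥3 }

    arc-in-blob₁ : ∀ {u v} → H 1F u v ≡ true → HasGoodDecomposition Q
    arc-in-blob₁ u→v = pattern⇒HasGoodDecomposition pattern-K2P2K3 λ
      { 0F → Kbar-embedding (n≥2 0F) ; 1F → P2-embedding (H-loopless 1F) u→v ; 2F → Kbar-embedding n₂≥3 }

    arc-in-blob₂ : ∀ {u v} → H 2F u v ≡ true → HasGoodDecomposition Q
    arc-in-blob₂ u→v = pattern⇒HasGoodDecomposition pattern-K2K2P2+K1 λ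
      { 0F → Kbar-embedding (n≥2 0F) ; 1F → Kbar-embedding (n≥2 1F) ; 2F → P2+K1-embedding n₂≥3 (H-loopless 2F) u→v }

  arcless⇒Exc1 : (∀ p → n p ≡ 2) → (∀ p → Arcless p) → Q ≅ Exc1
  arcless⇒Exc1 n≡2 arcless = compose-≅ {H′ = H-K2K2K2} ≅-refl λ
    { 0F → Kbar-≅ (n≡2 0F) (arcless 0F) ; 1F → Kbar-≅ (n≡2 1F) (arcless 1F) ; 2F → Kbar-≅ (n≡2 2F) (arcless 2F) }

  one-arc⇒Exc2 : (∀ p → n p ≡ 2) → ∀ {u v} → H 0F u v ≡ true → H 0F v u ≡ false →
    Arcless 1F → Arcless 2F → Q ≅ Exc2
  one-arc⇒Exc2 n≡2 u→v v↛u arcless₁ arcless₂ = compose-≅ {H′ = H-P2K2K2} ≅-refl λ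
    { 0F → P2-≅ (n≡2 0F) (H-loopless 0F) u→v v↛u ; 1F → Kbar-≅ (n≡2 1F) arcless₁ ; 2F → Kbar-≅ (n≡2 2F) arcless₂ }

  arcless⇒Exc3 : n 0F ≡ 2 → n 1F ≡ 2 → n 2F ≡ 3 → (∀ p → Arcless p) → Q ≅ Exc3
  arcless⇒Exc3 n₀≡2 n₁≡2 n₂≡3 arcless = compose-≅ {H′ = H-K2K2K3} ≅-refl λ
    { 0F → Kbar-≅ n₀≡2 (arcless 0F) ; 1F → Kbar-≅ n₁≡2 (arcless 1F) ; 2F → Kbar-≅ n₂≡3 (arcless 2F) }

  sizes-223 : n 0F ≡ 2 → n 1F ≡ 2 → n 2F ≡ 3 → GoodOrExceptional Q
  sizes-223 n₀≡2 n₁≡2 n₂≡3 with find-arc (H 0F) | find-arc (H 1F) | find-arc (H 2F)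
  ... | inj₁ (_ , _ , u→v) | _ | _ = inj₁ (arc-in-blob₀ (≤-reflexive (sym n₂≡3)) u→v)
  ... | inj₂ _ | inj₁ (_ , _ , u→v) | _ = inj₁ (arc-in-blob₁ (≤-reflexive (sym n₂≡3)) u→v)
  ... | inj₂ _ | inj₂ _ | inj₁ (_ , _ , u→v) = inj₁ (arc-in-blob₂ (≤-reflexive (sym n₂≡3)) u→v)
  ... | inj₂ arcless₀ | inj₂ arcless₁ | inj₂ arcless₂ =
    inj₂ (inj₂ (inj₂ (arcless⇒Exc3 n₀≡2 n₁≡2 n₂≡3 λ { 0F → arcless₀ ; 1F → arcless₁ ; 2F → arcless₂ })))

open Configurations

sizes-222-arc-in-blob₀ : ∀ B → (∀ p → BlowUpOfC3.n B p ≡ 2) → ∀ {u v} → BlowUpOfC3.H B 0F u v ≡ true →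
  GoodOrExceptional (BlowUpOfC3.Q B)
sizes-222-arc-in-blob₀ B n≡2 {u} {v} u→v with H 0F v u in v→u | find-arc (H 1F) | find-arc (H 2F)
  where open BlowUpOfC3 B
... | true | _ | _ = inj₁ (digon-in-blob₀ B u→v v→u)
... | false | inj₁ (_ , _ , u′→v′) | _ = inj₁ (arcs-in-blobs₀₁ B u→v u′→v′)
... | false | inj₂ _ | inj₁ (_ , _ , u′→v′) =
  rotated² B (inj₁ (arcs-in-blobs₀₁ (rotate-blobs (rotate-blobs B)) u′→v′ u→v))
... | false | inj₂ arcless₁ | inj₂ arcless₂ = inj₂ (inj₂ (inj₁ (one-arc⇒Exc2 B n≡2 u→v v→u arcless₁ arcless₂)))

sizes-222 : ∀ B → (∀ p → BlowUpOfC3.n B p ≡ 2) → GoodOrExceptional (BlowUpOfC3.Q B)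
sizes-222 B n≡2 with find-arc (H 0F) | find-arc (H 1F) | find-arc (H 2F)
  where open BlowUpOfC3 B
... | inj₁ (_ , _ , u→v) | _ | _ = sizes-222-arc-in-blob₀ B n≡2 u→v
... | inj₂ _ | inj₁ (_ , _ , u→v) | _ = rotated B (sizes-222-arc-in-blob₀ (rotate-blobs B) (n≡2 ∘ rotate) u→v)
... | inj₂ _ | inj₂ _ | inj₁ (_ , _ , u→v) =
  rotated² B (sizes-222-arc-in-blob₀ (rotate-blobs (rotate-blobs B)) (n≡2 ∘ rotate ∘ rotate) u→v)
... | inj₂ arcless₀ | inj₂ arcless₁ | inj₂ arcless₂ =
  inj₂ (inj₁ (arcless⇒Exc1 B n≡2 λ { 0F → arcless₀ ; 1F → arcless₁ ; 2F → arcless₂ }))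

decompose-C3 : ∀ B → GoodOrExceptional (BlowUpOfC3.Q B)
decompose-C3 B with size-class (n≥2 0F) | size-class (n≥2 1F) | size-class (n≥2 2F)
  where open BlowUpOfC3 B
... | inj₂ (inj₂ n₀≥4) | _ | _ = inj₁ (big-blob B n₀≥4)
... | _ | inj₂ (inj₂ n₁≥4) | _ = rotated B (inj₁ (big-blob (rotate-blobs B) n₁≥4))
... | _ | _ | inj₂ (inj₂ n₂≥4) = rotated² B (inj₁ (big-blob (rotate-blobs (rotate-blobs B)) n₂≥4))
... | inj₂ (inj₁ n₀≡3) | inj₂ (inj₁ n₁≡3) | _ =
  inj₁ (two-medium-blobs B (≤-reflexive (sym n₀≡3)) (≤-reflexive (sym n₁≡3)))
... | _ | inj₂ (inj₁ n₁≡3) | inj₂ (inj₁ n₂≡3) =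
  rotated B (inj₁ (two-medium-blobs (rotate-blobs B) (≤-reflexive (sym n₁≡3)) (≤-reflexive (sym n₂≡3))))
... | inj₂ (inj₁ n₀≡3) | _ | inj₂ (inj₁ n₂≡3) =
  rotated² B (inj₁ (two-medium-blobs (rotate-blobs (rotate-blobs B)) (≤-reflexive (sym n₂≡3)) (≤-reflexive (sym n₀≡3))))
... | inj₁ n₀≡2 | inj₁ n₁≡2 | inj₂ (inj₁ n₂≡3) = sizes-223 B n₀≡2 n₁≡2 n₂≡3
... | inj₂ (inj₁ n₀≡3) | inj₁ n₁≡2 | inj₁ n₂≡2 = rotated B (sizes-223 (rotate-blobs B) n₁≡2 n₂≡2 n₀≡3)
... | inj₁ n₀≡2 | inj₂ (inj₁ n₁≡3) | inj₁ n₂≡2 =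
  rotated² B (sizes-223 (rotate-blobs (rotate-blobs B)) n₂≡2 n₀≡2 n₁≡3)
... | inj₁ n₀≡2 | inj₁ n₁≡2 | inj₁ n₂≡2 = sizes-222 B λ { 0F → n₀≡2 ; 1F → n₁≡2 ; 2F → n₂≡2 }

-- The exceptional digraphs

module ArcColourings {size : Fin 3 → ℕ} (E : Digraph (Vertex size)) (arc-list : List (Vertex size × Vertex size))
  {arc-list-complete : True (all-vertices? λ u → all-vertices? λ v →
     (E u v Bool.≟ true) →-dec DecMembership._∈?_ _≟ₐ_ (u , v) arc-list)} where
  open DecMembership (_≟ᵥ_ {size}) using (_∈?_)

  arcs : Vec (Vertex size × Vertex size) (List.length arc-list)
  arcs = fromList arc-list

  in-cut : List (Vertex size) → Vertex size → Bool
  in-cut S v = does (v ∈? S)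

  leaving-true : List (Vertex size) → ∀ {n} → Vec (Vertex size × Vertex size) n → Vec Bool n → Bool
  leaving-true S [] _ = false
  leaving-true S ((u , v) ∷ as) bs = (in-cut S u ∧ not (in-cut S v) ∧ Vec.head bs) ∨ leaving-true S as (Vec.tail bs)

  Proper : List (Vertex size) → Set
  Proper S = (∃[ x ] x ∈ S) × (∃[ y ] ¬ y ∈ S)

  proper? : ∀ S → Dec (Proper S)
  proper? S = some-vertex? (_∈? S) ×-dec some-vertex? (¬? ∘ (_∈? S))

  Separating : Vec Bool (List.length arc-list) → Set
  Separating colours = ∀ S → {_ : True (proper? S)} → leaving-true S arcs colours ≡ true

  leaving-true-∈ : ∀ S (c : Vertex size × Vertex size → Bool) {u v} as → (u , v) ∈ as →
    in-cut S u ≡ true → in-cut S v ≡ false → c (u , v) ≡ true → leaving-true S (fromList as) (Vec.map c (fromList as)) ≡ true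
  leaving-true-∈ S c (_ ∷ as) (here refl) u∈S v∉S cuv =
    cong (_∨ leaving-true S (fromList as) (Vec.map c (fromList as))) (cong₂ _∧_ u∈S (cong₂ _∧_ (cong not v∉S) cuv))
  leaving-true-∈ S c ((u′ , v′) ∷ as) (there uv∈as) u∈S v∉S cuv =
    trans (cong (in-cut S u′ ∧ not (in-cut S v′) ∧ c (u′ , v′) ∨_) (leaving-true-∈ S c as uv∈as u∈S v∉S cuv))
      (∨-zeroʳ (in-cut S u′ ∧ not (in-cut S v′) ∧ c (u′ , v′)))

  colouring-separates : (c : Vertex size × Vertex size → Bool) (A : Digraph (Vertex size)) → A ⊆A E → Strong A →
    (∀ u v → A u v ≡ true → c (u , v) ≡ true) → Separating (Vec.map c arcs)
  colouring-separates c A A⊆E A-strong A⇒c S {proper} =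
    let (x , x∈S) , (y , y∉S) = toWitness proper
        u , v , u∈S , v∉S , u→v = cut-crossing (in-cut S) (A-strong x y λ x≡y → y∉S (subst (_∈ S) x≡y x∈S))
          (dec-true (x ∈? S) x∈S) (dec-false (y ∈? S) y∉S)
    in leaving-true-∈ S c arc-list (toWitness arc-list-complete u v (A⊆E u v u→v)) u∈S v∉S (A⇒c u v u→v)

  HasGoodDecomposition⇒separating : HasGoodDecomposition E →
    ∃[ colours ] Separating colours × Separating (Vec.map not colours)
  HasGoodDecomposition⇒separating (A₁ , A₂ , A₁⊆E , A₂⊆E , disjoint , strong₁ , strong₂) =
    Vec.map (uncurry A₁) arcs ,
    colouring-separates (uncurry A₁) A₁ A₁⊆E strong₁ (λ _ _ e → e) ,
    subst Separating (Vec.map-∘ not (uncurry A₁) arcs)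
      (colouring-separates (not ∘ uncurry A₁) A₂ A₂⊆E strong₂ A₂⇒not-A₁)
    where
    A₂⇒not-A₁ : ∀ u v → A₂ u v ≡ true → not (A₁ u v) ≡ true
    A₂⇒not-A₁ u v A₂uv with A₁ u v in A₁uv
    ... | true = ⊥-elim (disjoint u v (A₁uv , A₂uv))
    ... | false = refl

module Exc1-colourings = ArcColourings Exc1
  (0F ∙ 0F ⟶ 1F ∙ 0F ∷ 0F ∙ 0F ⟶ 1F ∙ 1F ∷ 0F ∙ 1F ⟶ 1F ∙ 0F ∷ 0F ∙ 1F ⟶ 1F ∙ 1F ∷
   1F ∙ 0F ⟶ 2F ∙ 0F ∷ 1F ∙ 0F ⟶ 2F ∙ 1F ∷ 1F ∙ 1F ⟶ 2F ∙ 0F ∷ 1F ∙ 1F ⟶ 2F ∙ 1F ∷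
   2F ∙ 0F ⟶ 0F ∙ 0F ∷ 2F ∙ 0F ⟶ 0F ∙ 1F ∷ 2F ∙ 1F ⟶ 0F ∙ 0F ∷ 2F ∙ 1F ⟶ 0F ∙ 1F ∷ [])

-- colours lists whether each arc of arc-list lies in the first half. Each clause fixes some colours
-- and names a proper cut S left by no arc of colour true (s₁) or of colour false (s₂).
Exc1-no-separating-colouring : ∀ colours → Exc1-colourings.Separating colours →
  Exc1-colourings.Separating (Vec.map not colours) → ⊥
Exc1-no-separating-colouring (true ∷ true ∷ _) s₁ s₂ = false≢true (s₂ (0F ∙ 0F ∷ []))
Exc1-no-separating-colouring (true ∷ false ∷ _ ∷ true ∷ true ∷ _ ∷ _ ∷ _ ∷ _ ∷ _ ∷ true ∷ _) s₁ s₂ = false≢true (s₂ (0F ∙ 1F ∷ 1F ∙ 0F ∷ 2F ∙ 1F ∷ []))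
Exc1-no-separating-colouring (true ∷ false ∷ true ∷ true ∷ true ∷ _ ∷ _ ∷ _ ∷ _ ∷ _ ∷ false ∷ _) s₁ s₂ = false≢true (s₂ (0F ∙ 1F ∷ []))
Exc1-no-separating-colouring (true ∷ false ∷ false ∷ true ∷ true ∷ _ ∷ true ∷ _ ∷ _ ∷ _ ∷ false ∷ _) s₁ s₂ = false≢true (s₂ (0F ∙ 0F ∷ 0F ∙ 1F ∷ 1F ∙ 0F ∷ 1F ∙ 1F ∷ 2F ∙ 1F ∷ []))
Exc1-no-separating-colouring (true ∷ false ∷ false ∷ true ∷ true ∷ _ ∷ false ∷ _ ∷ _ ∷ _ ∷ false ∷ _) s₁ s₂ = false≢true (s₁ (0F ∙ 1F ∷ 1F ∙ 1F ∷ 2F ∙ 1F ∷ []))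
Exc1-no-separating-colouring (true ∷ false ∷ _ ∷ false ∷ true ∷ _) s₁ s₂ = false≢true (s₁ (0F ∙ 0F ∷ 0F ∙ 1F ∷ 1F ∙ 0F ∷ 2F ∙ 0F ∷ 2F ∙ 1F ∷ []))
Exc1-no-separating-colouring (true ∷ false ∷ _ ∷ _ ∷ false ∷ _ ∷ true ∷ _ ∷ _ ∷ _ ∷ _ ∷ true ∷ []) s₁ s₂ = false≢true (s₂ (0F ∙ 0F ∷ 1F ∙ 1F ∷ 2F ∙ 1F ∷ []))
Exc1-no-separating-colouring (true ∷ false ∷ _ ∷ _ ∷ false ∷ _ ∷ true ∷ _ ∷ _ ∷ _ ∷ _ ∷ false ∷ []) s₁ s₂ = false≢true (s₁ (0F ∙ 0F ∷ 1F ∙ 0F ∷ 2F ∙ 1F ∷ []))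
Exc1-no-separating-colouring (true ∷ false ∷ _ ∷ _ ∷ false ∷ _ ∷ false ∷ _) s₁ s₂ = false≢true (s₁ (0F ∙ 0F ∷ 0F ∙ 1F ∷ 1F ∙ 0F ∷ 1F ∙ 1F ∷ 2F ∙ 1F ∷ []))
Exc1-no-separating-colouring (false ∷ true ∷ _ ∷ _ ∷ true ∷ _ ∷ true ∷ _) s₁ s₂ = false≢true (s₂ (0F ∙ 0F ∷ 0F ∙ 1F ∷ 1F ∙ 0F ∷ 1F ∙ 1F ∷ 2F ∙ 1F ∷ []))
Exc1-no-separating-colouring (false ∷ true ∷ _ ∷ _ ∷ true ∷ _ ∷ false ∷ _ ∷ _ ∷ _ ∷ _ ∷ true ∷ []) s₁ s₂ = false≢true (s₂ (0F ∙ 0F ∷ 1F ∙ 0F ∷ 2F ∙ 1F ∷ []))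
Exc1-no-separating-colouring (false ∷ true ∷ _ ∷ _ ∷ true ∷ _ ∷ false ∷ _ ∷ _ ∷ _ ∷ _ ∷ false ∷ []) s₁ s₂ = false≢true (s₁ (0F ∙ 0F ∷ 1F ∙ 1F ∷ 2F ∙ 1F ∷ []))
Exc1-no-separating-colouring (false ∷ true ∷ _ ∷ true ∷ false ∷ _) s₁ s₂ = false≢true (s₂ (0F ∙ 0F ∷ 0F ∙ 1F ∷ 1F ∙ 0F ∷ 2F ∙ 0F ∷ 2F ∙ 1F ∷ []))
Exc1-no-separating-colouring (false ∷ true ∷ true ∷ false ∷ false ∷ _ ∷ true ∷ _ ∷ _ ∷ _ ∷ true ∷ _) s₁ s₂ = false≢true (s₂ (0F ∙ 1F ∷ 1F ∙ 1F ∷ 2F ∙ 1F ∷ []))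
Exc1-no-separating-colouring (false ∷ true ∷ true ∷ false ∷ false ∷ _ ∷ false ∷ _ ∷ _ ∷ _ ∷ true ∷ _) s₁ s₂ = false≢true (s₁ (0F ∙ 0F ∷ 0F ∙ 1F ∷ 1F ∙ 0F ∷ 1F ∙ 1F ∷ 2F ∙ 1F ∷ []))
Exc1-no-separating-colouring (false ∷ true ∷ false ∷ false ∷ false ∷ _ ∷ _ ∷ _ ∷ _ ∷ _ ∷ true ∷ _) s₁ s₂ = false≢true (s₁ (0F ∙ 1F ∷ []))
Exc1-no-separating-colouring (false ∷ true ∷ _ ∷ false ∷ false ∷ _ ∷ _ ∷ _ ∷ _ ∷ _ ∷ false ∷ _) s₁ s₂ = false≢true (s₁ (0F ∙ 1F ∷ 1F ∙ 0F ∷ 2F ∙ 1F ∷ []))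
Exc1-no-separating-colouring (false ∷ false ∷ _) s₁ s₂ = false≢true (s₁ (0F ∙ 0F ∷ []))

Exc1-indecomposable : ¬ HasGoodDecomposition Exc1
Exc1-indecomposable good = let (colours , separating , separating-complement) = Exc1-colourings.HasGoodDecomposition⇒separating good
  in Exc1-no-separating-colouring colours separating separating-complement

module Exc2-colourings = ArcColourings Exc2
  (0F ∙ 0F ⟶ 0F ∙ 1F ∷ 0F ∙ 0F ⟶ 1F ∙ 0F ∷ 0F ∙ 0F ⟶ 1F ∙ 1F ∷ 0F ∙ 1F ⟶ 1F ∙ 0F ∷
   0F ∙ 1F ⟶ 1F ∙ 1F ∷ 1F ∙ 0F ⟶ 2F ∙ 0F ∷ 1F ∙ 0F ⟶ 2F ∙ 1F ∷ 1F ∙ 1F ⟶ 2F ∙ 0F ∷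
   1F ∙ 1F ⟶ 2F ∙ 1F ∷ 2F ∙ 0F ⟶ 0F ∙ 0F ∷ 2F ∙ 0F ⟶ 0F ∙ 1F ∷ 2F ∙ 1F ⟶ 0F ∙ 0F ∷
   2F ∙ 1F ⟶ 0F ∙ 1F ∷ [])

Exc2-no-separating-colouring : ∀ colours → Exc2-colourings.Separating colours →
  Exc2-colourings.Separating (Vec.map not colours) → ⊥
Exc2-no-separating-colouring (_ ∷ _ ∷ _ ∷ true ∷ true ∷ _) s₁ s₂ = false≢true (s₂ (0F ∙ 1F ∷ []))
Exc2-no-separating-colouring (_ ∷ _ ∷ _ ∷ true ∷ false ∷ true ∷ true ∷ _) s₁ s₂ = false≢true (s₂ (1F ∙ 0F ∷ []))
Exc2-no-separating-colouring (_ ∷ _ ∷ _ ∷ true ∷ false ∷ true ∷ false ∷ true ∷ _) s₁ s₂ = false≢true (s₂ (0F ∙ 0F ∷ 0F ∙ 1F ∷ 1F ∙ 0F ∷ 1F ∙ 1F ∷ 2F ∙ 1F ∷ []))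
Exc2-no-separating-colouring (_ ∷ _ ∷ _ ∷ true ∷ false ∷ true ∷ false ∷ false ∷ true ∷ true ∷ _) s₁ s₂ = false≢true (s₂ (0F ∙ 1F ∷ 1F ∙ 1F ∷ 2F ∙ 0F ∷ []))
Exc2-no-separating-colouring (_ ∷ _ ∷ _ ∷ true ∷ false ∷ true ∷ false ∷ false ∷ true ∷ false ∷ _) s₁ s₂ = false≢true (s₁ (0F ∙ 1F ∷ 1F ∙ 0F ∷ 2F ∙ 0F ∷ []))
Exc2-no-separating-colouring (_ ∷ _ ∷ _ ∷ true ∷ false ∷ true ∷ false ∷ false ∷ false ∷ _) s₁ s₂ = false≢true (s₁ (1F ∙ 1F ∷ []))
Exc2-no-separating-colouring (_ ∷ _ ∷ _ ∷ true ∷ false ∷ false ∷ _ ∷ true ∷ _ ∷ _ ∷ _ ∷ true ∷ _) s₁ s₂ = false≢true (s₂ (0F ∙ 1F ∷ 1F ∙ 1F ∷ 2F ∙ 1F ∷ []))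
Exc2-no-separating-colouring (_ ∷ _ ∷ _ ∷ true ∷ false ∷ false ∷ _ ∷ true ∷ _ ∷ _ ∷ _ ∷ false ∷ _) s₁ s₂ = false≢true (s₁ (0F ∙ 1F ∷ 1F ∙ 0F ∷ 2F ∙ 1F ∷ []))
Exc2-no-separating-colouring (_ ∷ _ ∷ _ ∷ true ∷ false ∷ false ∷ _ ∷ false ∷ _) s₁ s₂ = false≢true (s₁ (0F ∙ 0F ∷ 0F ∙ 1F ∷ 1F ∙ 0F ∷ 1F ∙ 1F ∷ 2F ∙ 1F ∷ []))
Exc2-no-separating-colouring (_ ∷ _ ∷ _ ∷ false ∷ true ∷ true ∷ _ ∷ true ∷ _) s₁ s₂ = false≢true (s₂ (0F ∙ 0F ∷ 0F ∙ 1F ∷ 1F ∙ 0F ∷ 1F ∙ 1F ∷ 2F ∙ 1F ∷ []))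
Exc2-no-separating-colouring (_ ∷ _ ∷ _ ∷ false ∷ true ∷ true ∷ _ ∷ false ∷ _ ∷ _ ∷ _ ∷ true ∷ _) s₁ s₂ = false≢true (s₂ (0F ∙ 1F ∷ 1F ∙ 0F ∷ 2F ∙ 1F ∷ []))
Exc2-no-separating-colouring (_ ∷ _ ∷ _ ∷ false ∷ true ∷ true ∷ _ ∷ false ∷ _ ∷ _ ∷ _ ∷ false ∷ _) s₁ s₂ = false≢true (s₁ (0F ∙ 1F ∷ 1F ∙ 1F ∷ 2F ∙ 1F ∷ []))
Exc2-no-separating-colouring (_ ∷ _ ∷ _ ∷ false ∷ true ∷ false ∷ true ∷ true ∷ true ∷ _) s₁ s₂ = false≢true (s₂ (1F ∙ 1F ∷ []))
Exc2-no-separating-colouring (_ ∷ _ ∷ _ ∷ false ∷ true ∷ false ∷ true ∷ true ∷ false ∷ true ∷ _) s₁ s₂ = false≢true (s₂ (0F ∙ 1F ∷ 1F ∙ 0F ∷ 2F ∙ 0F ∷ []))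
Exc2-no-separating-colouring (_ ∷ _ ∷ _ ∷ false ∷ true ∷ false ∷ true ∷ true ∷ false ∷ false ∷ _) s₁ s₂ = false≢true (s₁ (0F ∙ 1F ∷ 1F ∙ 1F ∷ 2F ∙ 0F ∷ []))
Exc2-no-separating-colouring (_ ∷ _ ∷ _ ∷ false ∷ true ∷ false ∷ true ∷ false ∷ _) s₁ s₂ = false≢true (s₁ (0F ∙ 0F ∷ 0F ∙ 1F ∷ 1F ∙ 0F ∷ 1F ∙ 1F ∷ 2F ∙ 1F ∷ []))
Exc2-no-separating-colouring (_ ∷ _ ∷ _ ∷ false ∷ true ∷ false ∷ false ∷ _) s₁ s₂ = false≢true (s₁ (1F ∙ 0F ∷ []))
Exc2-no-separating-colouring (_ ∷ _ ∷ _ ∷ false ∷ false ∷ _) s₁ s₂ = false≢true (s₁ (0F ∙ 1F ∷ []))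

Exc2-indecomposable : ¬ HasGoodDecomposition Exc2
Exc2-indecomposable good = let (colours , separating , separating-complement) = Exc2-colourings.HasGoodDecomposition⇒separating good
  in Exc2-no-separating-colouring colours separating separating-complement

module Exc3-colourings = ArcColourings Exc3
  (0F ∙ 0F ⟶ 1F ∙ 0F ∷ 0F ∙ 0F ⟶ 1F ∙ 1F ∷ 0F ∙ 1F ⟶ 1F ∙ 0F ∷ 0F ∙ 1F ⟶ 1F ∙ 1F ∷
   1F ∙ 0F ⟶ 2F ∙ 0F ∷ 1F ∙ 0F ⟶ 2F ∙ 1F ∷ 1F ∙ 0F ⟶ 2F ∙ 2F ∷ 1F ∙ 1F ⟶ 2F ∙ 0F ∷
   1F ∙ 1F ⟶ 2F ∙ 1F ∷ 1F ∙ 1F ⟶ 2F ∙ 2F ∷ 2F ∙ 0F ⟶ 0F ∙ 0F ∷ 2F ∙ 0F ⟶ 0F ∙ 1F ∷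
   2F ∙ 1F ⟶ 0F ∙ 0F ∷ 2F ∙ 1F ⟶ 0F ∙ 1F ∷ 2F ∙ 2F ⟶ 0F ∙ 0F ∷ 2F ∙ 2F ⟶ 0F ∙ 1F ∷ [])

Exc3-no-separating-colouring : ∀ colours → Exc3-colourings.Separating colours →
  Exc3-colourings.Separating (Vec.map not colours) → ⊥
Exc3-no-separating-colouring (true ∷ true ∷ _ ∷ _ ∷ true ∷ true ∷ _ ∷ _ ∷ _ ∷ _ ∷ _ ∷ _ ∷ _ ∷ _ ∷ true ∷ _) s₁ s₂ = false≢true (s₂ (0F ∙ 0F ∷ []))
Exc3-no-separating-colouring (true ∷ false ∷ _ ∷ true ∷ true ∷ true ∷ _ ∷ _ ∷ _ ∷ _ ∷ _ ∷ _ ∷ _ ∷ _ ∷ true ∷ _) s₁ s₂ = false≢true (s₂ (0F ∙ 1F ∷ 1F ∙ 0F ∷ 2F ∙ 2F ∷ []))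
Exc3-no-separating-colouring (true ∷ false ∷ _ ∷ false ∷ true ∷ true ∷ _ ∷ _ ∷ _ ∷ _ ∷ _ ∷ _ ∷ _ ∷ _ ∷ true ∷ _) s₁ s₂ = false≢true (s₁ (0F ∙ 0F ∷ 0F ∙ 1F ∷ 1F ∙ 0F ∷ 2F ∙ 0F ∷ 2F ∙ 1F ∷ 2F ∙ 2F ∷ []))
Exc3-no-separating-colouring (true ∷ _ ∷ _ ∷ _ ∷ true ∷ true ∷ _ ∷ true ∷ _ ∷ _ ∷ _ ∷ _ ∷ _ ∷ _ ∷ false ∷ _) s₁ s₂ = false≢true (s₂ (0F ∙ 0F ∷ 0F ∙ 1F ∷ 1F ∙ 0F ∷ 1F ∙ 1F ∷ 2F ∙ 1F ∷ 2F ∙ 2F ∷ []))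
Exc3-no-separating-colouring (true ∷ _ ∷ _ ∷ _ ∷ true ∷ true ∷ _ ∷ false ∷ true ∷ _ ∷ _ ∷ _ ∷ _ ∷ _ ∷ false ∷ _) s₁ s₂ = false≢true (s₂ (0F ∙ 0F ∷ 0F ∙ 1F ∷ 1F ∙ 0F ∷ 1F ∙ 1F ∷ 2F ∙ 0F ∷ 2F ∙ 2F ∷ []))
Exc3-no-separating-colouring (true ∷ _ ∷ true ∷ _ ∷ true ∷ true ∷ _ ∷ false ∷ false ∷ _ ∷ _ ∷ _ ∷ _ ∷ _ ∷ false ∷ true ∷ []) s₁ s₂ = false≢true (s₂ (0F ∙ 0F ∷ 0F ∙ 1F ∷ 1F ∙ 1F ∷ 2F ∙ 0F ∷ 2F ∙ 1F ∷ 2F ∙ 2F ∷ []))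
Exc3-no-separating-colouring (true ∷ _ ∷ false ∷ _ ∷ true ∷ true ∷ _ ∷ false ∷ false ∷ _ ∷ _ ∷ _ ∷ _ ∷ _ ∷ false ∷ true ∷ []) s₁ s₂ = false≢true (s₁ (0F ∙ 1F ∷ 1F ∙ 1F ∷ 2F ∙ 2F ∷ []))
Exc3-no-separating-colouring (true ∷ _ ∷ _ ∷ _ ∷ true ∷ true ∷ _ ∷ false ∷ false ∷ _ ∷ _ ∷ _ ∷ _ ∷ _ ∷ false ∷ false ∷ []) s₁ s₂ = false≢true (s₁ (2F ∙ 2F ∷ []))
Exc3-no-separating-colouring (false ∷ true ∷ _ ∷ _ ∷ true ∷ true ∷ _ ∷ _ ∷ _ ∷ _ ∷ _ ∷ _ ∷ _ ∷ _ ∷ _ ∷ true ∷ []) s₁ s₂ = false≢true (s₂ (0F ∙ 0F ∷ 1F ∙ 0F ∷ 2F ∙ 2F ∷ []))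
Exc3-no-separating-colouring (false ∷ false ∷ _ ∷ _ ∷ true ∷ true ∷ _ ∷ _ ∷ _ ∷ _ ∷ _ ∷ _ ∷ _ ∷ _ ∷ _ ∷ true ∷ []) s₁ s₂ = false≢true (s₁ (0F ∙ 0F ∷ []))
Exc3-no-separating-colouring (false ∷ _ ∷ _ ∷ _ ∷ true ∷ true ∷ _ ∷ true ∷ _ ∷ _ ∷ _ ∷ _ ∷ _ ∷ _ ∷ _ ∷ false ∷ []) s₁ s₂ = false≢true (s₂ (0F ∙ 0F ∷ 0F ∙ 1F ∷ 1F ∙ 0F ∷ 1F ∙ 1F ∷ 2F ∙ 1F ∷ 2F ∙ 2F ∷ []))
Exc3-no-separating-colouring (false ∷ _ ∷ _ ∷ _ ∷ true ∷ true ∷ _ ∷ false ∷ true ∷ _ ∷ _ ∷ _ ∷ _ ∷ _ ∷ _ ∷ false ∷ []) s₁ s₂ = false≢true (s₂ (0F ∙ 0F ∷ 0F ∙ 1F ∷ 1F ∙ 0F ∷ 1F ∙ 1F ∷ 2F ∙ 0F ∷ 2F ∙ 2F ∷ []))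
Exc3-no-separating-colouring (false ∷ _ ∷ _ ∷ _ ∷ true ∷ true ∷ _ ∷ false ∷ false ∷ _ ∷ _ ∷ _ ∷ _ ∷ _ ∷ _ ∷ false ∷ []) s₁ s₂ = false≢true (s₁ (0F ∙ 0F ∷ 1F ∙ 1F ∷ 2F ∙ 2F ∷ []))
Exc3-no-separating-colouring (true ∷ true ∷ _ ∷ _ ∷ true ∷ false ∷ _ ∷ _ ∷ _ ∷ true ∷ _) s₁ s₂ = false≢true (s₂ (0F ∙ 0F ∷ []))
Exc3-no-separating-colouring (false ∷ true ∷ _ ∷ true ∷ true ∷ false ∷ _ ∷ _ ∷ _ ∷ true ∷ _) s₁ s₂ = false≢true (s₂ (0F ∙ 0F ∷ 0F ∙ 1F ∷ 1F ∙ 0F ∷ 2F ∙ 1F ∷ 2F ∙ 2F ∷ []))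
Exc3-no-separating-colouring (false ∷ true ∷ true ∷ false ∷ true ∷ false ∷ true ∷ _ ∷ _ ∷ true ∷ _) s₁ s₂ = false≢true (s₂ (0F ∙ 0F ∷ 0F ∙ 1F ∷ 1F ∙ 0F ∷ 1F ∙ 1F ∷ 2F ∙ 0F ∷ 2F ∙ 1F ∷ []))
Exc3-no-separating-colouring (false ∷ true ∷ true ∷ false ∷ true ∷ false ∷ false ∷ true ∷ _ ∷ true ∷ _) s₁ s₂ = false≢true (s₂ (0F ∙ 0F ∷ 0F ∙ 1F ∷ 1F ∙ 0F ∷ 1F ∙ 1F ∷ 2F ∙ 1F ∷ 2F ∙ 2F ∷ []))
Exc3-no-separating-colouring (false ∷ true ∷ true ∷ false ∷ true ∷ false ∷ false ∷ false ∷ true ∷ true ∷ true ∷ _) s₁ s₂ = false≢true (s₂ (0F ∙ 1F ∷ 1F ∙ 1F ∷ 2F ∙ 0F ∷ []))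
Exc3-no-separating-colouring (false ∷ true ∷ true ∷ false ∷ true ∷ false ∷ false ∷ false ∷ true ∷ true ∷ false ∷ _) s₁ s₂ = false≢true (s₁ (0F ∙ 1F ∷ 1F ∙ 0F ∷ 2F ∙ 0F ∷ []))
Exc3-no-separating-colouring (false ∷ true ∷ true ∷ false ∷ true ∷ false ∷ false ∷ false ∷ false ∷ true ∷ _) s₁ s₂ = false≢true (s₁ (0F ∙ 0F ∷ 0F ∙ 1F ∷ 1F ∙ 0F ∷ 1F ∙ 1F ∷ 2F ∙ 0F ∷ 2F ∙ 2F ∷ []))
Exc3-no-separating-colouring (false ∷ true ∷ false ∷ false ∷ true ∷ false ∷ _ ∷ _ ∷ _ ∷ true ∷ _) s₁ s₂ = false≢true (s₁ (0F ∙ 1F ∷ []))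
Exc3-no-separating-colouring (_ ∷ true ∷ _ ∷ _ ∷ true ∷ false ∷ true ∷ _ ∷ _ ∷ false ∷ _ ∷ _ ∷ _ ∷ true ∷ _) s₁ s₂ = false≢true (s₂ (0F ∙ 0F ∷ 1F ∙ 0F ∷ 2F ∙ 1F ∷ []))
Exc3-no-separating-colouring (_ ∷ true ∷ _ ∷ _ ∷ true ∷ false ∷ false ∷ _ ∷ _ ∷ false ∷ _ ∷ _ ∷ _ ∷ true ∷ _) s₁ s₂ = false≢true (s₁ (0F ∙ 0F ∷ 0F ∙ 1F ∷ 1F ∙ 0F ∷ 1F ∙ 1F ∷ 2F ∙ 0F ∷ 2F ∙ 1F ∷ []))
Exc3-no-separating-colouring (_ ∷ true ∷ _ ∷ true ∷ true ∷ false ∷ true ∷ _ ∷ _ ∷ false ∷ _ ∷ _ ∷ _ ∷ false ∷ _) s₁ s₂ = false≢true (s₂ (0F ∙ 0F ∷ 0F ∙ 1F ∷ 1F ∙ 0F ∷ 2F ∙ 1F ∷ []))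
Exc3-no-separating-colouring (true ∷ true ∷ _ ∷ false ∷ true ∷ false ∷ true ∷ _ ∷ _ ∷ false ∷ _ ∷ _ ∷ _ ∷ false ∷ _) s₁ s₂ = false≢true (s₂ (0F ∙ 0F ∷ []))
Exc3-no-separating-colouring (false ∷ true ∷ true ∷ false ∷ true ∷ false ∷ true ∷ true ∷ _ ∷ false ∷ _ ∷ _ ∷ _ ∷ false ∷ _) s₁ s₂ = false≢true (s₂ (0F ∙ 0F ∷ 0F ∙ 1F ∷ 1F ∙ 0F ∷ 1F ∙ 1F ∷ 2F ∙ 1F ∷ 2F ∙ 2F ∷ []))
Exc3-no-separating-colouring (false ∷ true ∷ true ∷ false ∷ true ∷ false ∷ true ∷ false ∷ _ ∷ false ∷ _ ∷ _ ∷ _ ∷ false ∷ _) s₁ s₂ = false≢true (s₁ (0F ∙ 0F ∷ 1F ∙ 1F ∷ 2F ∙ 1F ∷ []))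
Exc3-no-separating-colouring (false ∷ true ∷ false ∷ false ∷ true ∷ false ∷ true ∷ _ ∷ _ ∷ false ∷ _ ∷ _ ∷ _ ∷ false ∷ _) s₁ s₂ = false≢true (s₁ (0F ∙ 1F ∷ []))
Exc3-no-separating-colouring (_ ∷ true ∷ _ ∷ _ ∷ true ∷ false ∷ false ∷ _ ∷ _ ∷ false ∷ _ ∷ _ ∷ _ ∷ false ∷ _) s₁ s₂ = false≢true (s₁ (0F ∙ 0F ∷ 0F ∙ 1F ∷ 1F ∙ 0F ∷ 1F ∙ 1F ∷ 2F ∙ 0F ∷ 2F ∙ 1F ∷ []))
Exc3-no-separating-colouring (_ ∷ false ∷ _ ∷ _ ∷ true ∷ false ∷ true ∷ _ ∷ _ ∷ true ∷ _ ∷ true ∷ _) s₁ s₂ = false≢true (s₂ (0F ∙ 0F ∷ 0F ∙ 1F ∷ 1F ∙ 0F ∷ 1F ∙ 1F ∷ 2F ∙ 0F ∷ 2F ∙ 1F ∷ []))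
Exc3-no-separating-colouring (true ∷ false ∷ true ∷ true ∷ true ∷ false ∷ false ∷ _ ∷ _ ∷ true ∷ _ ∷ true ∷ _) s₁ s₂ = false≢true (s₂ (0F ∙ 1F ∷ []))
Exc3-no-separating-colouring (true ∷ false ∷ false ∷ true ∷ true ∷ false ∷ false ∷ _ ∷ true ∷ true ∷ _ ∷ true ∷ _) s₁ s₂ = false≢true (s₂ (0F ∙ 0F ∷ 1F ∙ 1F ∷ 2F ∙ 0F ∷ []))
Exc3-no-separating-colouring (true ∷ false ∷ false ∷ true ∷ true ∷ false ∷ false ∷ _ ∷ false ∷ true ∷ _ ∷ true ∷ _) s₁ s₂ = false≢true (s₁ (0F ∙ 0F ∷ 0F ∙ 1F ∷ 1F ∙ 0F ∷ 1F ∙ 1F ∷ 2F ∙ 0F ∷ 2F ∙ 2F ∷ []))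
Exc3-no-separating-colouring (false ∷ false ∷ _ ∷ true ∷ true ∷ false ∷ false ∷ _ ∷ _ ∷ true ∷ _ ∷ true ∷ _) s₁ s₂ = false≢true (s₁ (0F ∙ 0F ∷ []))
Exc3-no-separating-colouring (_ ∷ false ∷ _ ∷ false ∷ true ∷ false ∷ false ∷ _ ∷ _ ∷ true ∷ _ ∷ true ∷ _) s₁ s₂ = false≢true (s₁ (0F ∙ 0F ∷ 0F ∙ 1F ∷ 1F ∙ 0F ∷ 2F ∙ 0F ∷ []))
Exc3-no-separating-colouring (_ ∷ false ∷ _ ∷ _ ∷ true ∷ false ∷ true ∷ _ ∷ _ ∷ true ∷ _ ∷ false ∷ _) s₁ s₂ = false≢true (s₂ (0F ∙ 0F ∷ 0F ∙ 1F ∷ 1F ∙ 0F ∷ 1F ∙ 1F ∷ 2F ∙ 0F ∷ 2F ∙ 1F ∷ []))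
Exc3-no-separating-colouring (_ ∷ false ∷ _ ∷ _ ∷ true ∷ false ∷ false ∷ _ ∷ _ ∷ true ∷ _ ∷ false ∷ _) s₁ s₂ = false≢true (s₁ (0F ∙ 0F ∷ 1F ∙ 0F ∷ 2F ∙ 0F ∷ []))
Exc3-no-separating-colouring (_ ∷ false ∷ _ ∷ true ∷ true ∷ false ∷ true ∷ _ ∷ _ ∷ false ∷ _ ∷ _ ∷ true ∷ _) s₁ s₂ = false≢true (s₂ (0F ∙ 1F ∷ 1F ∙ 0F ∷ 2F ∙ 1F ∷ []))
Exc3-no-separating-colouring (_ ∷ false ∷ _ ∷ true ∷ true ∷ false ∷ false ∷ _ ∷ _ ∷ false ∷ _ ∷ _ ∷ true ∷ _) s₁ s₂ = false≢true (s₁ (0F ∙ 0F ∷ 0F ∙ 1F ∷ 1F ∙ 0F ∷ 1F ∙ 1F ∷ 2F ∙ 0F ∷ 2F ∙ 1F ∷ []))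
Exc3-no-separating-colouring (_ ∷ false ∷ _ ∷ false ∷ true ∷ false ∷ _ ∷ _ ∷ _ ∷ false ∷ _ ∷ _ ∷ true ∷ _) s₁ s₂ = false≢true (s₁ (0F ∙ 0F ∷ 0F ∙ 1F ∷ 1F ∙ 0F ∷ 2F ∙ 0F ∷ 2F ∙ 2F ∷ []))
Exc3-no-separating-colouring (_ ∷ false ∷ true ∷ true ∷ true ∷ false ∷ true ∷ _ ∷ _ ∷ false ∷ _ ∷ _ ∷ false ∷ _) s₁ s₂ = false≢true (s₂ (0F ∙ 1F ∷ []))
Exc3-no-separating-colouring (true ∷ false ∷ false ∷ true ∷ true ∷ false ∷ true ∷ true ∷ _ ∷ false ∷ _ ∷ _ ∷ false ∷ _) s₁ s₂ = false≢true (s₂ (0F ∙ 0F ∷ 0F ∙ 1F ∷ 1F ∙ 0F ∷ 1F ∙ 1F ∷ 2F ∙ 1F ∷ 2F ∙ 2F ∷ []))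
Exc3-no-separating-colouring (true ∷ false ∷ false ∷ true ∷ true ∷ false ∷ true ∷ false ∷ _ ∷ false ∷ _ ∷ _ ∷ false ∷ _) s₁ s₂ = false≢true (s₁ (0F ∙ 1F ∷ 1F ∙ 1F ∷ 2F ∙ 1F ∷ []))
Exc3-no-separating-colouring (false ∷ false ∷ false ∷ true ∷ true ∷ false ∷ true ∷ _ ∷ _ ∷ false ∷ _ ∷ _ ∷ false ∷ _) s₁ s₂ = false≢true (s₁ (0F ∙ 0F ∷ []))
Exc3-no-separating-colouring (_ ∷ false ∷ _ ∷ true ∷ true ∷ false ∷ false ∷ _ ∷ _ ∷ false ∷ _ ∷ _ ∷ false ∷ _) s₁ s₂ = false≢true (s₁ (0F ∙ 0F ∷ 0F ∙ 1F ∷ 1F ∙ 0F ∷ 1F ∙ 1F ∷ 2F ∙ 0F ∷ 2F ∙ 1F ∷ []))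
Exc3-no-separating-colouring (_ ∷ false ∷ _ ∷ false ∷ true ∷ false ∷ _ ∷ _ ∷ _ ∷ false ∷ _ ∷ _ ∷ false ∷ _) s₁ s₂ = false≢true (s₁ (0F ∙ 0F ∷ 0F ∙ 1F ∷ 1F ∙ 0F ∷ 2F ∙ 0F ∷ 2F ∙ 2F ∷ []))
Exc3-no-separating-colouring (_ ∷ true ∷ _ ∷ true ∷ false ∷ true ∷ _ ∷ _ ∷ _ ∷ true ∷ _ ∷ _ ∷ true ∷ _) s₁ s₂ = false≢true (s₂ (0F ∙ 0F ∷ 0F ∙ 1F ∷ 1F ∙ 0F ∷ 2F ∙ 0F ∷ 2F ∙ 2F ∷ []))
Exc3-no-separating-colouring (_ ∷ true ∷ _ ∷ false ∷ false ∷ true ∷ true ∷ _ ∷ _ ∷ true ∷ _ ∷ _ ∷ true ∷ _) s₁ s₂ = false≢true (s₂ (0F ∙ 0F ∷ 0F ∙ 1F ∷ 1F ∙ 0F ∷ 1F ∙ 1F ∷ 2F ∙ 0F ∷ 2F ∙ 1F ∷ []))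
Exc3-no-separating-colouring (true ∷ true ∷ true ∷ false ∷ false ∷ true ∷ false ∷ _ ∷ _ ∷ true ∷ _ ∷ _ ∷ true ∷ _) s₁ s₂ = false≢true (s₂ (0F ∙ 0F ∷ []))
Exc3-no-separating-colouring (false ∷ true ∷ true ∷ false ∷ false ∷ true ∷ false ∷ true ∷ _ ∷ true ∷ _ ∷ _ ∷ true ∷ _) s₁ s₂ = false≢true (s₂ (0F ∙ 1F ∷ 1F ∙ 1F ∷ 2F ∙ 1F ∷ []))
Exc3-no-separating-colouring (false ∷ true ∷ true ∷ false ∷ false ∷ true ∷ false ∷ false ∷ _ ∷ true ∷ _ ∷ _ ∷ true ∷ _) s₁ s₂ = false≢true (s₁ (0F ∙ 0F ∷ 0F ∙ 1F ∷ 1F ∙ 0F ∷ 1F ∙ 1F ∷ 2F ∙ 1F ∷ 2F ∙ 2F ∷ []))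
Exc3-no-separating-colouring (_ ∷ true ∷ false ∷ false ∷ false ∷ true ∷ false ∷ _ ∷ _ ∷ true ∷ _ ∷ _ ∷ true ∷ _) s₁ s₂ = false≢true (s₁ (0F ∙ 1F ∷ []))
Exc3-no-separating-colouring (_ ∷ true ∷ _ ∷ true ∷ false ∷ true ∷ _ ∷ _ ∷ _ ∷ true ∷ _ ∷ _ ∷ false ∷ _) s₁ s₂ = false≢true (s₂ (0F ∙ 0F ∷ 0F ∙ 1F ∷ 1F ∙ 0F ∷ 2F ∙ 0F ∷ 2F ∙ 2F ∷ []))
Exc3-no-separating-colouring (_ ∷ true ∷ _ ∷ false ∷ false ∷ true ∷ true ∷ _ ∷ _ ∷ true ∷ _ ∷ _ ∷ false ∷ _) s₁ s₂ = false≢true (s₂ (0F ∙ 0F ∷ 0F ∙ 1F ∷ 1F ∙ 0F ∷ 1F ∙ 1F ∷ 2F ∙ 0F ∷ 2F ∙ 1F ∷ []))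
Exc3-no-separating-colouring (_ ∷ true ∷ _ ∷ false ∷ false ∷ true ∷ false ∷ _ ∷ _ ∷ true ∷ _ ∷ _ ∷ false ∷ _) s₁ s₂ = false≢true (s₁ (0F ∙ 1F ∷ 1F ∙ 0F ∷ 2F ∙ 1F ∷ []))
Exc3-no-separating-colouring (_ ∷ true ∷ _ ∷ _ ∷ false ∷ true ∷ true ∷ _ ∷ _ ∷ false ∷ _ ∷ true ∷ _) s₁ s₂ = false≢true (s₂ (0F ∙ 0F ∷ 1F ∙ 0F ∷ 2F ∙ 0F ∷ []))
Exc3-no-separating-colouring (_ ∷ true ∷ _ ∷ _ ∷ false ∷ true ∷ false ∷ _ ∷ _ ∷ false ∷ _ ∷ true ∷ _) s₁ s₂ = false≢true (s₁ (0F ∙ 0F ∷ 0F ∙ 1F ∷ 1F ∙ 0F ∷ 1F ∙ 1F ∷ 2F ∙ 0F ∷ 2F ∙ 1F ∷ []))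
Exc3-no-separating-colouring (_ ∷ true ∷ _ ∷ true ∷ false ∷ true ∷ true ∷ _ ∷ _ ∷ false ∷ _ ∷ false ∷ _) s₁ s₂ = false≢true (s₂ (0F ∙ 0F ∷ 0F ∙ 1F ∷ 1F ∙ 0F ∷ 2F ∙ 0F ∷ []))
Exc3-no-separating-colouring (true ∷ true ∷ _ ∷ false ∷ false ∷ true ∷ true ∷ _ ∷ _ ∷ false ∷ _ ∷ false ∷ _) s₁ s₂ = false≢true (s₂ (0F ∙ 0F ∷ []))
Exc3-no-separating-colouring (false ∷ true ∷ true ∷ false ∷ false ∷ true ∷ true ∷ _ ∷ true ∷ false ∷ _ ∷ false ∷ _) s₁ s₂ = false≢true (s₂ (0F ∙ 0F ∷ 0F ∙ 1F ∷ 1F ∙ 0F ∷ 1F ∙ 1F ∷ 2F ∙ 0F ∷ 2F ∙ 2F ∷ []))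
Exc3-no-separating-colouring (false ∷ true ∷ true ∷ false ∷ false ∷ true ∷ true ∷ _ ∷ false ∷ false ∷ _ ∷ false ∷ _) s₁ s₂ = false≢true (s₁ (0F ∙ 0F ∷ 1F ∙ 1F ∷ 2F ∙ 0F ∷ []))
Exc3-no-separating-colouring (false ∷ true ∷ false ∷ false ∷ false ∷ true ∷ true ∷ _ ∷ _ ∷ false ∷ _ ∷ false ∷ _) s₁ s₂ = false≢true (s₁ (0F ∙ 1F ∷ []))
Exc3-no-separating-colouring (_ ∷ true ∷ _ ∷ _ ∷ false ∷ true ∷ false ∷ _ ∷ _ ∷ false ∷ _ ∷ false ∷ _) s₁ s₂ = false≢true (s₁ (0F ∙ 0F ∷ 0F ∙ 1F ∷ 1F ∙ 0F ∷ 1F ∙ 1F ∷ 2F ∙ 0F ∷ 2F ∙ 1F ∷ []))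
Exc3-no-separating-colouring (_ ∷ false ∷ _ ∷ _ ∷ false ∷ true ∷ true ∷ _ ∷ _ ∷ true ∷ _ ∷ _ ∷ _ ∷ true ∷ _) s₁ s₂ = false≢true (s₂ (0F ∙ 0F ∷ 0F ∙ 1F ∷ 1F ∙ 0F ∷ 1F ∙ 1F ∷ 2F ∙ 0F ∷ 2F ∙ 1F ∷ []))
Exc3-no-separating-colouring (true ∷ false ∷ true ∷ true ∷ false ∷ true ∷ false ∷ _ ∷ _ ∷ true ∷ _ ∷ _ ∷ _ ∷ true ∷ _) s₁ s₂ = false≢true (s₂ (0F ∙ 1F ∷ []))
Exc3-no-separating-colouring (true ∷ false ∷ false ∷ true ∷ false ∷ true ∷ false ∷ true ∷ _ ∷ true ∷ _ ∷ _ ∷ _ ∷ true ∷ _) s₁ s₂ = false≢true (s₂ (0F ∙ 0F ∷ 1F ∙ 1F ∷ 2F ∙ 1F ∷ []))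
Exc3-no-separating-colouring (true ∷ false ∷ false ∷ true ∷ false ∷ true ∷ false ∷ false ∷ _ ∷ true ∷ _ ∷ _ ∷ _ ∷ true ∷ _) s₁ s₂ = false≢true (s₁ (0F ∙ 0F ∷ 0F ∙ 1F ∷ 1F ∙ 0F ∷ 1F ∙ 1F ∷ 2F ∙ 1F ∷ 2F ∙ 2F ∷ []))
Exc3-no-separating-colouring (false ∷ false ∷ _ ∷ true ∷ false ∷ true ∷ false ∷ _ ∷ _ ∷ true ∷ _ ∷ _ ∷ _ ∷ true ∷ _) s₁ s₂ = false≢true (s₁ (0F ∙ 0F ∷ []))
Exc3-no-separating-colouring (_ ∷ false ∷ _ ∷ false ∷ false ∷ true ∷ false ∷ _ ∷ _ ∷ true ∷ _ ∷ _ ∷ _ ∷ true ∷ _) s₁ s₂ = false≢true (s₁ (0F ∙ 0F ∷ 0F ∙ 1F ∷ 1F ∙ 0F ∷ 2F ∙ 1F ∷ []))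
Exc3-no-separating-colouring (_ ∷ false ∷ _ ∷ _ ∷ false ∷ true ∷ true ∷ _ ∷ _ ∷ true ∷ _ ∷ _ ∷ _ ∷ false ∷ _) s₁ s₂ = false≢true (s₂ (0F ∙ 0F ∷ 0F ∙ 1F ∷ 1F ∙ 0F ∷ 1F ∙ 1F ∷ 2F ∙ 0F ∷ 2F ∙ 1F ∷ []))
Exc3-no-separating-colouring (_ ∷ false ∷ _ ∷ _ ∷ false ∷ true ∷ false ∷ _ ∷ _ ∷ true ∷ _ ∷ _ ∷ _ ∷ false ∷ _) s₁ s₂ = false≢true (s₁ (0F ∙ 0F ∷ 1F ∙ 0F ∷ 2F ∙ 1F ∷ []))
Exc3-no-separating-colouring (true ∷ false ∷ true ∷ true ∷ false ∷ true ∷ _ ∷ _ ∷ _ ∷ false ∷ _) s₁ s₂ = false≢true (s₂ (0F ∙ 1F ∷ []))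
Exc3-no-separating-colouring (true ∷ false ∷ false ∷ true ∷ false ∷ true ∷ true ∷ true ∷ true ∷ false ∷ _) s₁ s₂ = false≢true (s₂ (0F ∙ 0F ∷ 0F ∙ 1F ∷ 1F ∙ 0F ∷ 1F ∙ 1F ∷ 2F ∙ 0F ∷ 2F ∙ 2F ∷ []))
Exc3-no-separating-colouring (true ∷ false ∷ false ∷ true ∷ false ∷ true ∷ true ∷ true ∷ false ∷ false ∷ true ∷ _) s₁ s₂ = false≢true (s₂ (0F ∙ 1F ∷ 1F ∙ 0F ∷ 2F ∙ 0F ∷ []))
Exc3-no-separating-colouring (true ∷ false ∷ false ∷ true ∷ false ∷ true ∷ true ∷ true ∷ false ∷ false ∷ false ∷ _) s₁ s₂ = false≢true (s₁ (0F ∙ 1F ∷ 1F ∙ 1F ∷ 2F ∙ 0F ∷ []))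
Exc3-no-separating-colouring (true ∷ false ∷ false ∷ true ∷ false ∷ true ∷ true ∷ false ∷ _ ∷ false ∷ _) s₁ s₂ = false≢true (s₁ (0F ∙ 0F ∷ 0F ∙ 1F ∷ 1F ∙ 0F ∷ 1F ∙ 1F ∷ 2F ∙ 1F ∷ 2F ∙ 2F ∷ []))
Exc3-no-separating-colouring (true ∷ false ∷ false ∷ true ∷ false ∷ true ∷ false ∷ _ ∷ _ ∷ false ∷ _) s₁ s₂ = false≢true (s₁ (0F ∙ 0F ∷ 0F ∙ 1F ∷ 1F ∙ 0F ∷ 1F ∙ 1F ∷ 2F ∙ 0F ∷ 2F ∙ 1F ∷ []))
Exc3-no-separating-colouring (true ∷ false ∷ _ ∷ false ∷ false ∷ true ∷ _ ∷ _ ∷ _ ∷ false ∷ _) s₁ s₂ = false≢true (s₁ (0F ∙ 0F ∷ 0F ∙ 1F ∷ 1F ∙ 0F ∷ 2F ∙ 1F ∷ 2F ∙ 2F ∷ []))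
Exc3-no-separating-colouring (false ∷ false ∷ _ ∷ _ ∷ false ∷ true ∷ _ ∷ _ ∷ _ ∷ false ∷ _) s₁ s₂ = false≢true (s₁ (0F ∙ 0F ∷ []))
Exc3-no-separating-colouring (true ∷ _ ∷ _ ∷ _ ∷ false ∷ false ∷ _ ∷ true ∷ true ∷ _ ∷ _ ∷ _ ∷ _ ∷ _ ∷ _ ∷ true ∷ []) s₁ s₂ = false≢true (s₂ (0F ∙ 0F ∷ 1F ∙ 1F ∷ 2F ∙ 2F ∷ []))
Exc3-no-separating-colouring (true ∷ _ ∷ _ ∷ _ ∷ false ∷ false ∷ _ ∷ true ∷ false ∷ _ ∷ _ ∷ _ ∷ _ ∷ _ ∷ _ ∷ true ∷ []) s₁ s₂ = false≢true (s₁ (0F ∙ 0F ∷ 0F ∙ 1F ∷ 1F ∙ 0F ∷ 1F ∙ 1F ∷ 2F ∙ 0F ∷ 2F ∙ 2F ∷ []))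
Exc3-no-separating-colouring (true ∷ _ ∷ _ ∷ _ ∷ false ∷ false ∷ _ ∷ false ∷ _ ∷ _ ∷ _ ∷ _ ∷ _ ∷ _ ∷ _ ∷ true ∷ []) s₁ s₂ = false≢true (s₁ (0F ∙ 0F ∷ 0F ∙ 1F ∷ 1F ∙ 0F ∷ 1F ∙ 1F ∷ 2F ∙ 1F ∷ 2F ∙ 2F ∷ []))
Exc3-no-separating-colouring (true ∷ true ∷ _ ∷ _ ∷ false ∷ false ∷ _ ∷ _ ∷ _ ∷ _ ∷ _ ∷ _ ∷ _ ∷ _ ∷ _ ∷ false ∷ []) s₁ s₂ = false≢true (s₂ (0F ∙ 0F ∷ []))
Exc3-no-separating-colouring (true ∷ false ∷ _ ∷ _ ∷ false ∷ false ∷ _ ∷ _ ∷ _ ∷ _ ∷ _ ∷ _ ∷ _ ∷ _ ∷ _ ∷ false ∷ []) s₁ s₂ = false≢true (s₁ (0F ∙ 0F ∷ 1F ∙ 0F ∷ 2F ∙ 2F ∷ []))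
Exc3-no-separating-colouring (false ∷ _ ∷ _ ∷ _ ∷ false ∷ false ∷ _ ∷ true ∷ true ∷ _ ∷ _ ∷ _ ∷ _ ∷ _ ∷ true ∷ true ∷ []) s₁ s₂ = false≢true (s₂ (2F ∙ 2F ∷ []))
Exc3-no-separating-colouring (false ∷ _ ∷ true ∷ _ ∷ false ∷ false ∷ _ ∷ true ∷ true ∷ _ ∷ _ ∷ _ ∷ _ ∷ _ ∷ true ∷ false ∷ []) s₁ s₂ = false≢true (s₂ (0F ∙ 1F ∷ 1F ∙ 1F ∷ 2F ∙ 2F ∷ []))
Exc3-no-separating-colouring (false ∷ _ ∷ false ∷ _ ∷ false ∷ false ∷ _ ∷ true ∷ true ∷ _ ∷ _ ∷ _ ∷ _ ∷ _ ∷ true ∷ false ∷ []) s₁ s₂ = false≢true (s₁ (0F ∙ 0F ∷ 0F ∙ 1F ∷ 1F ∙ 1F ∷ 2F ∙ 0F ∷ 2F ∙ 1F ∷ 2F ∙ 2F ∷ []))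
Exc3-no-separating-colouring (false ∷ _ ∷ _ ∷ _ ∷ false ∷ false ∷ _ ∷ true ∷ false ∷ _ ∷ _ ∷ _ ∷ _ ∷ _ ∷ true ∷ _) s₁ s₂ = false≢true (s₁ (0F ∙ 0F ∷ 0F ∙ 1F ∷ 1F ∙ 0F ∷ 1F ∙ 1F ∷ 2F ∙ 0F ∷ 2F ∙ 2F ∷ []))
Exc3-no-separating-colouring (false ∷ _ ∷ _ ∷ _ ∷ false ∷ false ∷ _ ∷ false ∷ _ ∷ _ ∷ _ ∷ _ ∷ _ ∷ _ ∷ true ∷ _) s₁ s₂ = false≢true (s₁ (0F ∙ 0F ∷ 0F ∙ 1F ∷ 1F ∙ 0F ∷ 1F ∙ 1F ∷ 2F ∙ 1F ∷ 2F ∙ 2F ∷ []))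
Exc3-no-separating-colouring (false ∷ true ∷ _ ∷ true ∷ false ∷ false ∷ _ ∷ _ ∷ _ ∷ _ ∷ _ ∷ _ ∷ _ ∷ _ ∷ false ∷ _) s₁ s₂ = false≢true (s₂ (0F ∙ 0F ∷ 0F ∙ 1F ∷ 1F ∙ 0F ∷ 2F ∙ 0F ∷ 2F ∙ 1F ∷ 2F ∙ 2F ∷ []))
Exc3-no-separating-colouring (false ∷ true ∷ _ ∷ false ∷ false ∷ false ∷ _ ∷ _ ∷ _ ∷ _ ∷ _ ∷ _ ∷ _ ∷ _ ∷ false ∷ _) s₁ s₂ = false≢true (s₁ (0F ∙ 1F ∷ 1F ∙ 0F ∷ 2F ∙ 2F ∷ []))
Exc3-no-separating-colouring (false ∷ false ∷ _ ∷ _ ∷ false ∷ false ∷ _ ∷ _ ∷ _ ∷ _ ∷ _ ∷ _ ∷ _ ∷ _ ∷ false ∷ _) s₁ s₂ = false≢true (s₁ (0F ∙ 0F ∷ []))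

Exc3-indecomposable : ¬ HasGoodDecomposition Exc3
Exc3-indecomposable good = let (colours , separating , separating-complement) = Exc3-colourings.HasGoodDecomposition⇒separating good
  in Exc3-no-separating-colouring colours separating separating-complement

digon-free⇒oriented : ∀ {t} {T : Digraph (Fin t)} → ¬ (∃[ u ] ∃[ v ] T u v ≡ true × T v u ≡ true) →
  ∀ u v → T u v ≡ true → T v u ≡ false
digon-free⇒oriented digon-free u v u→v = ¬-not λ v→u → digon-free (u , v , u→v , v→u)

decompose : ∀ {t} → 2 ≤ t → (T : Digraph (Fin t)) → Loopless T → Strong T → Semicomplete T →
  {ns : Fin t → ℕ} → (∀ i → 2 ≤ ns i) → (H : (i : Fin t) → Digraph (Fin (ns i))) → (∀ i → Loopless (H i)) →
  GoodOrExceptional (compose T H)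
decompose t≥2 T T-loopless T-strong T-semicomplete {ns} ns≥2 H H-loopless
  with any? (λ u → any? (λ v → (T u v Bool.≟ true) ×-dec (T v u Bool.≟ true)))
... | yes (u , v , u→v , v→u) =
  inj₁ (VoltageLift.digon⇒HasGoodDecomposition T T-loopless T-strong t≥2 ns≥2 H u v u→v v→u)
... | no digon-free
  with StrongTournament.four-cycle-or-C3 T T-loopless T-strong T-semicomplete (digon-free⇒oriented digon-free) t≥2
... | inj₁ cycle = inj₁ (VoltageLift.four-cycle⇒HasGoodDecomposition T T-loopless T-strong t≥2 ns≥2 H cycle)
... | inj₂ C3≅T = GoodOrExceptional-resp-≅ (compose-≅ {H = H ∘ corner} C3≅T λ _ → ≅-refl)
  (decompose-C3 record { n = ns ∘ corner ; H = H ∘ corner ; H-loopless = H-loopless ∘ corner ; n≥2 = ns≥2 ∘ corner })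
  where
  corner : Fin 3 → Fin _
  corner = Bijection.to (proj₁ C3≅T)

theorem2p3 : (t : ℕ) → 2 ≤ t → (T : Digraph (Fin t)) → Loopless T → Strong T → Semicomplete T →
    (ns : Fin t → ℕ) → (∀ i → 2 ≤ ns i) →
    (H : (i : Fin t) → Digraph (Fin (ns i))) → (∀ i → Loopless (H i)) →
    HasGoodDecomposition (compose T H) ⇔
      (¬ (compose T H ≅ Exc1) × ¬ (compose T H ≅ Exc2) × ¬ (compose T H ≅ Exc3))
theorem2p3 t t≥2 T T-loopless T-strong T-semicomplete ns ns≥2 H H-loopless = mk⇔
  (λ good → (λ iso → Exc1-indecomposable (HasGoodDecomposition-resp-≅ {E = Exc1} iso good)) ,
            (λ iso → Exc2-indecomposable (HasGoodDecomposition-resp-≅ {E = Exc2} iso good)) ,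
            (λ iso → Exc3-indecomposable (HasGoodDecomposition-resp-≅ {E = Exc3} iso good)))
  (λ (¬exc₁ , ¬exc₂ , ¬exc₃) → [ id , [ ⊥-elim ∘ ¬exc₁ , [ ⊥-elim ∘ ¬exc₂ , ⊥-elim ∘ ¬exc₃ ]′ ]′ ]′
    (decompose t≥2 T T-loopless T-strong T-semicomplete ns≥2 H H-loopless))
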